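{- Let $G$ be a connected graph. Run the following Greedy-Max-Genus Algorithm on $G$: set $H \leftarrow G$ and $P \leftarrow \emptyset$; repeatedly choose a pair of adjacent edges $e,f$ of $H$ that has not yet been tested, and if $H-\{e,f\}$ is connected, set $H \leftarrow H-\{e,f\}$ and add the pair $\{e,f\}$ to $P$; stop when all pairs of adjacent edges of the current graph $H$ have been tested, and output $P$. Then, regardless of the order in which the pairs are chosen, the output set $P$ contains at least $\gamma_M(G)/2$ pairs of adjacent edges.
   Context: Graphs are finite and undirected, with loops and parallel edges permitted. Two distinct edges are adjacent if they share a common end-vertex. Embeddings are cellular embeddings in orientable surfaces. The maximum genus $\gamma_M(G)$ of a connected graph $G$ is the largest integer $g$ such that $G$ has a cellular embedding in the orientable surface of genus $g$. For a set $F$ of edges, $H-F$ denotes the spanning subgraph of $H$ obtained by deleting the edges in $F$ (all vertices are kept). The pairs placed in $P$ are pairwise disjoint, and $G$ minus all edges of the pairs in $P$ is a connected spanning subgraph of $G$. -}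

module Defs where

open import Data.Nat using (ℕ; zero; suc; _+_; _*_; _≤_; _<_; _≤?_; _⊔_)
open import Data.Fin using (Fin; toℕ; _≟_)
open import Data.Fin.Properties using ()
open import Data.Bool using (Bool; true; false; _∧_; not; if_then_else_)
open import Data.Product using (_×_; _,_; proj₁; proj₂; ∃; Σ)
open import Data.Sum using (_⊎_)
open import Data.List using (List; []; _∷_; _++_; length; upTo; allFin; concatMap)
open import Data.List.Membership.Propositional using (_∈_)
open import Relation.Binary.PropositionalEquality using (_≡_)
open import Relation.Nullary using (¬_)
open import Relation.Nullary.Decidable using (⌊_⌋)
open import Relation.Binary.Construct.Closure.ReflexiveTransitive using (Star)

-- Finite multigraphs (loops and parallel edges allowed).
-- Vertices are Fin nV, edges are Fin nE; edge e has end-vertices ends e.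

record Graph : Set where
  field
    nV   : ℕ
    nE   : ℕ
    ends : Fin nE → Fin nV × Fin nV

module _ (G : Graph) where
  open Graph G

  -- spanning subgraphs are given by their edge sets
  EdgeSet : Set
  EdgeSet = Fin nE → Bool

  allEdges : EdgeSet
  allEdges _ = true

  IsEnd : Fin nV → Fin nE → Set
  IsEnd v e = (proj₁ (ends e) ≡ v) ⊎ (proj₂ (ends e) ≡ v)

  Joins : Fin nE → Fin nV → Fin nV → Set
  Joins e x y = (ends e ≡ (x , y)) ⊎ (ends e ≡ (y , x))

  data Reach (S : EdgeSet) (u : Fin nV) : Fin nV → Set where
    here : Reach S u u
    step : ∀ {x y} (e : Fin nE) → S e ≡ true → Joins e x y →
           Reach S u x → Reach S u y

  -- the spanning subgraph with edge set S is connected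
  -- (a connected graph is nonempty)
  ConnectedSub : EdgeSet → Set
  ConnectedSub S = (1 ≤ nV) × (∀ u v → Reach S u v)

  Adjacent : Fin nE → Fin nE → Set
  Adjacent e f = (¬ e ≡ f) × ∃ λ v → IsEnd v e × IsEnd v f

  removePair : EdgeSet → Fin nE → Fin nE → EdgeSet
  removePair S e f x = S x ∧ not ⌊ x ≟ e ⌋ ∧ not ⌊ x ≟ f ⌋

  -- Maximum genus via rotation systems (Heffter–Edmonds).
  -- Darts: (e , false) is the half-edge of e at proj₁ (ends e),
  --        (e , true)  is the half-edge of e at proj₂ (ends e).

  Dart : Set
  Dart = Fin nE × Bool

  dartVertex : Dart → Fin nV
  dartVertex (e , false) = proj₁ (ends e)
  dartVertex (e , true)  = proj₂ (ends e)

  flipDart : Dart → Dart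
  flipDart (e , b) = (e , not b)

  iter : (Dart → Dart) → ℕ → Dart → Dart
  iter f zero    d = d
  iter f (suc k) d = f (iter f k d)

  record Rotation : Set where
    field
      ρ        : Dart → Dart
      ρ⁻¹      : Dart → Dart
      invˡ     : ∀ d → ρ⁻¹ (ρ d) ≡ d
      invʳ     : ∀ d → ρ (ρ⁻¹ d) ≡ d
      local    : ∀ d → dartVertex (ρ d) ≡ dartVertex d
      cyclic   : ∀ d d' → dartVertex d ≡ dartVertex d' →
                 ∃ λ k → iter ρ k d ≡ d'

  allDarts : List Dart
  allDarts = concatMap (λ e → (e , false) ∷ (e , true) ∷ []) (allFin nE)

  dartCode : Dart → ℕ
  dartCode (e , b) = 2 * toℕ e + (if b then 1 else 0)

  allB : (ℕ → Bool) → List ℕ → Bool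
  allB p []       = true
  allB p (k ∷ ks) = p k ∧ allB p ks

  countTrue : (Dart → Bool) → List Dart → ℕ
  countTrue p []       = 0
  countTrue p (d ∷ ds) = if p d then suc (countTrue p ds) else countTrue p ds

  -- face-tracing permutation of the embedding determined by R
  facePerm : Rotation → Dart → Dart
  facePerm R d = Rotation.ρ R (flipDart d)

  -- d has the least code in its facePerm-orbit (orbits have length ≤ 2 nE)
  isOrbitRep : Rotation → Dart → Bool
  isOrbitRep R d =
    allB (λ k → ⌊ dartCode d ≤? dartCode (iter (facePerm R) k d) ⌋) (upTo (2 * nE))

  -- number of faces (a graph with no edges has a single face)
  faceCount : Rotation → ℕ
  faceCount R = 1 ⊔ countTrue (isOrbitRep R) allDarts

  -- G has a cellular embedding in the orientable surface of genus g:
  -- some rotation system with  V - E + F = 2 - 2g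
  EmbeddableInGenus : ℕ → Set
  EmbeddableInGenus g =
    Σ Rotation λ R → nV + faceCount R + 2 * g ≡ 2 + nE

  IsMaxGenus : ℕ → Set
  IsMaxGenus g = EmbeddableInGenus g × (∀ g' → EmbeddableInGenus g' → g' ≤ g)

  record State : Set where
    constructor ⟨_,_,_⟩
    field
      H      : EdgeSet
      P      : List (Fin nE × Fin nE)
      tested : List (Fin nE × Fin nE)

  Tested : List (Fin nE × Fin nE) → Fin nE → Fin nE → Set
  Tested T e f = ((e , f) ∈ T) ⊎ ((f , e) ∈ T)

  initState : State
  initState = ⟨ allEdges , [] , [] ⟩

  data Step : State → State → Set where
    accept : ∀ {H P T} (e f : Fin nE) →
             H e ≡ true → H f ≡ true → Adjacent e f → ¬ Tested T e f →
             ConnectedSub (removePair H e f) →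
             Step ⟨ H , P , T ⟩ ⟨ removePair H e f , P ++ ((e , f) ∷ []) , (e , f) ∷ T ⟩
    reject : ∀ {H P T} (e f : Fin nE) →
             H e ≡ true → H f ≡ true → Adjacent e f → ¬ Tested T e f →
             ¬ ConnectedSub (removePair H e f) →
             Step ⟨ H , P , T ⟩ ⟨ H , P , (e , f) ∷ T ⟩

  Run : State → Set
  Run s = Star Step initState s

  Terminated : State → Set
  Terminated s = ∀ e f → State.H s e ≡ true → State.H s f ≡ true →
                 Adjacent e f → Tested (State.tested s) e f

-- Let H be the graph the algorithm stops with.  It is connected, has E − 2|P| edges, and no
-- two adjacent edges of H can be deleted together without disconnecting it, since that pair was
-- tested and rejected for a supergraph of H.  Every rotation system of such a graph has genus 0,
-- i.e. at least E(H) − V + 2 faces.  This goes by induction on the number of edges: a bridge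
-- splits H into two smaller graphs of the same kind with F(H) = F(H₁) + F(H₂) − 1; without a
-- bridge, a loop beside another edge or three edges at one vertex would give a deletable pair,
-- so H is a cycle and its two sides are distinct faces.
-- Deleting the edges of P from a maximum-genus rotation system of G yields a rotation system of
-- H, and each deletion costs at most one face, so F(G) ≥ E(H) − V + 2 − 2|P|; Euler's formula
-- V − E + F = 2 − 2γ then gives γ_M(G) ≤ 2|P|.  Faces are counted from below by lists of darts
-- lying on pairwise distinct faces, and the counting runs in the double-negation monad, which
-- is harmless because the conclusion is decidable.

module Submission where

open import Defs
open import Data.Nat using (ℕ; zero; suc; _+_; _*_; _≤_; _<_; z≤n; s≤s; _≤?_)
open import Data.Nat.Properties using (≤-refl; ≤-trans; ≤-reflexive; ≤-pred; n<1+n; <⇒≱; ≰⇒>; m≤m+n; m≤n+m; m≤m⊔n; m≤n⊔m; m≤n⇒∃[o]m+o≡n; +-comm; +-assoc; +-suc; +-identityʳ; +-mono-≤; +-monoˡ-≤; +-monoʳ-≤; +-mono-<; +-cancelʳ-≤; +-cancelˡ-≡; *-distribˡ-+; *-cancelˡ-≤; +-0-commutativeMonoid; +-commutativeSemigroup)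
open import Data.Nat.Solver using (module +-*-Solver)
open import Data.Bool using (Bool; true; false; _∧_; not; if_then_else_)
import Data.Bool.Properties as Bool
open import Data.Fin using (Fin; zero; suc; toℕ; _≟_; combine; fromℕ<)
import Data.Fin.Properties as Fin
open import Data.Product using (_×_; _,_; proj₁; proj₂; ∃-syntax)
open import Data.Product.Properties using (≡-dec)
open import Data.Sum using (_⊎_; inj₁; inj₂)
import Data.Sum as Sum
open import Data.Empty using (⊥; ⊥-elim)
open import Data.Unit using (⊤; tt)
open import Data.List using (List; []; _∷_; length; map; filter; tabulate; allFin; upTo; _++_)
open import Data.List.Properties using (length-map; length-++; filter-all)
open import Data.List.Membership.Propositional using (_∈_)
open import Data.List.Membership.Propositional.Properties using (∈-filter⁺; ∈-filter⁻; ∈-allFin; ∈-map⁺; ∈-map⁻; ∈-++⁺ˡ; ∈-++⁺ʳ; ∈-++⁻; ∈-concatMap⁺)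
open import Data.List.Relation.Unary.Any using (here; there)
import Data.List.Relation.Unary.Any as Any
open import Data.List.Relation.Unary.All using (All; []; _∷_)
import Data.List.Relation.Unary.All as All
import Data.List.Relation.Unary.All.Properties as All
open import Data.List.Relation.Unary.AllPairs using (AllPairs; []; _∷_)
import Data.List.Relation.Unary.AllPairs as AllPairs
import Data.List.Relation.Unary.AllPairs.Properties as AllPairs
open import Data.List.Relation.Unary.Unique.Propositional using (Unique)
import Data.List.Relation.Unary.Unique.Propositional.Properties as Unique
open import Data.List.Relation.Binary.Sublist.Propositional using (_⊆_; []; _∷_; _∷ʳ_; ⊆-refl; ⊆-trans)
open import Data.List.Relation.Binary.Sublist.Propositional.Properties using (All-resp-⊆)
open import Algebra.Properties.CommutativeSemigroup +-commutativeSemigroup using (interchange)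
open import Function using (_∘_; id)
open import Function.Definitions using (Injective)
import Function.Endo.Propositional
open import Relation.Binary.Definitions using (DecidableEquality)
open import Relation.Binary.PropositionalEquality
open import Relation.Binary.Construct.Closure.ReflexiveTransitive using (Star; ε; _◅_)
open import Relation.Nullary using (¬_; Dec; yes; no; ¬?)
open import Relation.Nullary.Decidable using (⌊_⌋; ¬¬-excluded-middle; decidable-stable)
open import Relation.Nullary.Negation using (¬¬-Monad; contradiction)
open import Effect.Monad using (RawMonad)
open import Level using (0ℓ)

open RawMonad (¬¬-Monad {0ℓ}) using (_>>=_; return)

¬¬-decide-Fin : ∀ {n} (P : Fin n → Set) → ¬ ¬ (∀ i → Dec (P i))
¬¬-decide-Fin {zero}  P = return λ ()
¬¬-decide-Fin {suc n} P = do
  P₀? ← ¬¬-excluded-middle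
  P₊? ← ¬¬-decide-Fin (P ∘ suc)
  return λ { zero → P₀? ; (suc i) → P₊? i }

module Counting where

  open import Algebra.Properties.CommutativeMonoid.Sum +-0-commutativeMonoid public
    using (sum; sum-cong-≗; sum-replicate-zero; ∑-distrib-+; ∑-comm)

  bit : Bool → ℕ
  bit false = 0
  bit true  = 1

  count : ∀ {n} → (Fin n → Bool) → ℕ
  count p = sum (bit ∘ p)

  sum-mono-≤ : ∀ {n} {f g : Fin n → ℕ} → (∀ i → f i ≤ g i) → sum f ≤ sum g
  sum-mono-≤ {zero}  _   = z≤n
  sum-mono-≤ {suc n} f≤g = +-mono-≤ (f≤g zero) (sum-mono-≤ (f≤g ∘ suc))

  count-false : ∀ {n} (p : Fin n → Bool) → (∀ i → p i ≡ false) → count p ≡ 0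
  count-false {zero}  p _       = refl
  count-false {suc n} p p≡false rewrite p≡false zero = count-false (p ∘ suc) (p≡false ∘ suc)

  count-true : ∀ n → count {n} (λ _ → true) ≡ n
  count-true zero    = refl
  count-true (suc n) = cong suc (count-true n)

  count-pos : ∀ {n} {p : Fin n → Bool} i → p i ≡ true → 0 < count p
  count-pos {p = p} zero    pi≡true rewrite pi≡true = s≤s z≤n
  count-pos {p = p} (suc i) pi≡true = ≤-trans (count-pos i pi≡true) (m≤n+m _ (bit (p zero)))

  count-singleton : ∀ {n} (i : Fin n) → count (λ j → ⌊ j ≟ i ⌋) ≡ 1
  count-singleton {suc n} zero    = cong suc (count-false {n} (λ j → ⌊ suc j ≟ zero ⌋) λ _ → refl)
  count-singleton {suc n} (suc i) = trans (sum-cong-≗ (cong bit ∘ suc-≟)) (count-singleton i)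
    where
    suc-≟ : ∀ j → ⌊ suc j ≟ suc i ⌋ ≡ ⌊ j ≟ i ⌋
    suc-≟ j with j ≟ i
    ... | yes _ = refl
    ... | no _  = refl

  count-split : ∀ {n} (p q : Fin n → Bool) →
                count (λ i → p i ∧ q i) + count (λ i → p i ∧ not (q i)) ≡ count p
  count-split p q = trans (sym (∑-distrib-+ (bit ∘ λ i → p i ∧ q i) (bit ∘ λ i → p i ∧ not (q i))))
                          (sum-cong-≗ λ i → bits (p i) (q i))
    where
    bits : ∀ a b → bit (a ∧ b) + bit (a ∧ not b) ≡ bit a
    bits false _     = refl
    bits true  false = refl
    bits true  true  = refl

  count-remove : ∀ {n} (p : Fin n → Bool) i → p i ≡ true →
                 count (λ j → p j ∧ not ⌊ j ≟ i ⌋) + 1 ≡ count p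
  count-remove p i pi≡true = begin
    count (λ j → p j ∧ not ⌊ j ≟ i ⌋) + 1
      ≡⟨ cong (count (λ j → p j ∧ not ⌊ j ≟ i ⌋) +_) (sym (count-singleton i)) ⟩
    count (λ j → p j ∧ not ⌊ j ≟ i ⌋) + count (λ j → ⌊ j ≟ i ⌋)
      ≡⟨ cong (count (λ j → p j ∧ not ⌊ j ≟ i ⌋) +_) (sum-cong-≗ (cong bit ∘ at-i)) ⟩
    count (λ j → p j ∧ not ⌊ j ≟ i ⌋) + count (λ j → p j ∧ not (not ⌊ j ≟ i ⌋))
      ≡⟨ count-split p (λ j → not ⌊ j ≟ i ⌋) ⟩
    count p ∎
    where
    open ≡-Reasoning
    at-i : ∀ j → ⌊ j ≟ i ⌋ ≡ p j ∧ not (not ⌊ j ≟ i ⌋)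
    at-i j with j ≟ i
    ... | yes refl = sym (cong (_∧ true) pi≡true)
    ... | no _     = sym (Bool.∧-zeroʳ (p j))

  count-filter : ∀ {A : Set} {n} (f : Fin n → A) (p : A → Bool) →
                 count (p ∘ f) + length (filter (λ a → p a Bool.≟ false) (tabulate f)) ≡ n
  count-filter {n = zero}  f p = refl
  count-filter {n = suc n} f p with p (f zero)
  ... | true  = cong suc (count-filter (f ∘ suc) p)
  ... | false = trans (+-suc _ _) (cong suc (count-filter (f ∘ suc) p))

module Orbits {A : Set} (f : A → A) where

  open import Function.Endo.Propositional A using (_^_; ^-homo)

  SameOrbit : A → A → Set
  SameOrbit x y = ∃[ k ] (f ^ k) x ≡ y

  DistinctOrbits : List A → Set
  DistinctOrbits = AllPairs (λ x y → ¬ SameOrbit x y)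

  ^-+ : ∀ m n x → (f ^ (m + n)) x ≡ (f ^ m) ((f ^ n) x)
  ^-+ m n x = cong-app (^-homo f m n) x

  ^-suc : ∀ n x → (f ^ suc n) x ≡ (f ^ n) (f x)
  ^-suc n x = trans (cong (λ k → (f ^ k) x) (+-comm 1 n)) (^-+ n 1 x)

  ^-injective : Injective _≡_ _≡_ f → ∀ k → Injective _≡_ _≡_ (f ^ k)
  ^-injective f-inj zero    eq = eq
  ^-injective f-inj (suc k) eq = ^-injective f-inj k (f-inj eq)

  ^-closed : ∀ {P : A → Set} → (∀ {x} → P x → P (f x)) → ∀ k {x} → P x → P ((f ^ k) x)
  ^-closed P-closed zero    px = px
  ^-closed {P} P-closed (suc k) {x} px = P-closed {(f ^ k) x} (^-closed {P} P-closed k px)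

  orbit-refl : ∀ x → SameOrbit x x
  orbit-refl x = 0 , refl

  orbit-trans : ∀ {x y z} → SameOrbit x y → SameOrbit y z → SameOrbit x z
  orbit-trans {x} (m , refl) (n , refl) = n + m , ^-+ n m x

  orbit-step : ∀ {x y} → SameOrbit x y → SameOrbit x (f y)
  orbit-step (k , refl) = suc k , refl

  orbit-stepˡ : ∀ {x y} → SameOrbit (f x) y → SameOrbit x y
  orbit-stepˡ {x} (k , refl) = suc k , ^-suc k x

  orbit-closed : ∀ {P : A → Set} → (∀ {x} → P x → P (f x)) → ∀ {x y} → SameOrbit x y → P x → P y
  orbit-closed {P} P-closed (k , refl) = ^-closed {P} P-closed k

  distinctOrbits-++ : ∀ {P Q : A → Set} → (∀ {x} → P x → P (f x)) → (∀ {x} → P x → ¬ Q x) →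
                      ∀ {W₁ W₂} → DistinctOrbits W₁ → DistinctOrbits W₂ → All P W₁ → All Q W₂ →
                      DistinctOrbits (W₁ ++ W₂)
  distinctOrbits-++ {P} P-closed P⇒¬Q distinct₁ distinct₂ PW₁ QW₂ = AllPairs.++⁺ distinct₁ distinct₂
    (All.map (λ Px → All.map (λ Qy x~y → P⇒¬Q (orbit-closed {P} P-closed x~y Px) Qy) QW₂) PW₁)

module _ {A : Set} where

  open Function.Endo.Propositional A using (_^_)
  open Orbits using (SameOrbit)

  ^-cong : ∀ {f g : A → A} → f ≗ g → ∀ k → (f ^ k) ≗ (g ^ k)
  ^-cong         f≗g zero    x = refl
  ^-cong {g = g} f≗g (suc k) x = trans (f≗g _) (cong g (^-cong f≗g k x))

  orbit-cong : ∀ {f g : A → A} → f ≗ g → ∀ {x y} → SameOrbit f x y → SameOrbit g x y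
  orbit-cong f≗g (k , refl) = k , sym (^-cong f≗g k _)

  distinctOrbits-cong : ∀ {f g : A → A} → f ≗ g → ∀ {W} →
                        Orbits.DistinctOrbits f W → Orbits.DistinctOrbits g W
  distinctOrbits-cong f≗g [] = []
  distinctOrbits-cong f≗g (x∉ ∷ W) =
    All.map (λ ¬x~y x~y → ¬x~y (orbit-cong (sym ∘ f≗g) x~y)) x∉ ∷ distinctOrbits-cong f≗g W

module FiniteOrbits {A : Set} {n : ℕ} (code : A → Fin n) (code-injective : Injective _≡_ _≡_ code)
                    {f : A → A} (f-injective : Injective _≡_ _≡_ f) where

  open Function.Endo.Propositional A using (_^_)
  open Orbits f

  period : ∀ x → ∃[ N ] (f ^ suc N) x ≡ x
  period x with Fin.pigeonhole (n<1+n n) (λ i → code ((f ^ toℕ i) x))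
  ... | i , j , i<j , same-code with m≤n⇒∃[o]m+o≡n i<j
  ... | N , i+N≡j = N , sym (^-injective f-injective (toℕ i) (begin
    (f ^ toℕ i) x              ≡⟨ code-injective same-code ⟩
    (f ^ toℕ j) x              ≡⟨ cong (λ k → (f ^ k) x) (trans (sym i+N≡j) (sym (+-suc (toℕ i) N))) ⟩
    (f ^ (toℕ i + suc N)) x    ≡⟨ ^-+ (toℕ i) (suc N) x ⟩
    (f ^ toℕ i) ((f ^ suc N) x) ∎))
    where open ≡-Reasoning

  preimage : ∀ y → ∃[ x ] f x ≡ y
  preimage y with period y
  ... | N , fᴺ⁺¹y≡y = (f ^ N) y , fᴺ⁺¹y≡y

  orbit-back : ∀ x → SameOrbit (f x) x
  orbit-back x with period x
  ... | N , fᴺ⁺¹x≡x = N , trans (sym (^-suc N x)) fᴺ⁺¹x≡x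

  orbit-sym : ∀ {x y} → SameOrbit x y → SameOrbit y x
  orbit-sym {x} (k , refl) = back k
    where
    back : ∀ k → SameOrbit ((f ^ k) x) x
    back zero    = orbit-refl x
    back (suc k) = orbit-trans (orbit-back _) (back k)

  -- Distinct orbits meet the orbit of c at most once.
  avoid-orbit : ∀ c {W} → DistinctOrbits W →
                ¬ ¬ (∃[ W′ ] W′ ⊆ W × DistinctOrbits W′ × All (λ x → ¬ SameOrbit x c) W′ ×
                             length W ≤ suc (length W′))
  avoid-orbit c {[]} [] = return ([] , [] , [] , [] , z≤n)
  avoid-orbit c {x ∷ W} (x≁W ∷ distinct) = do
    yes x~c ← ¬¬-excluded-middle
      where no x≁c → do
        W′ , W′⊆W , distinct′ , W′≁c , |W|≤ ← avoid-orbit c distinct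
        return (x ∷ W′ , refl ∷ W′⊆W , All-resp-⊆ W′⊆W x≁W ∷ distinct′ , x≁c ∷ W′≁c , s≤s |W|≤)
    return (W , x ∷ʳ ⊆-refl , distinct ,
            All.map (λ x≁y y~c → x≁y (orbit-trans x~c (orbit-sym y~c))) x≁W , n<1+n _)

module Transpositions {A : Set} (_≟ᴬ_ : DecidableEquality A) where

  open Function.Endo.Propositional A using (_^_)
  open Orbits using (SameOrbit; DistinctOrbits)

  swap : A → A → A → A
  swap a b x with x ≟ᴬ a
  ... | yes _ = b
  ... | no _ with x ≟ᴬ b
  ...   | yes _ = a
  ...   | no _  = x

  swap-other : ∀ {a b x} → ¬ x ≡ a → ¬ x ≡ b → swap a b x ≡ x
  swap-other {a} {b} {x} x≢a x≢b with x ≟ᴬ a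
  ... | yes x≡a = contradiction x≡a x≢a
  ... | no _ with x ≟ᴬ b
  ...   | yes x≡b = contradiction x≡b x≢b
  ...   | no _    = refl

  module _ {f g : A → A} {a b : A} (f≗g∘swap : f ≗ g ∘ swap a b) where

    orbit-swap : ∀ {x y} → SameOrbit f x y → SameOrbit g x y ⊎ SameOrbit g x a ⊎ SameOrbit g x b
    orbit-swap {x} (zero , refl) = inj₁ (Orbits.orbit-refl g x)
    orbit-swap {x} (suc k , refl) with orbit-swap (k , refl)
    ... | inj₂ x~a⊎x~b = inj₂ x~a⊎x~b
    ... | inj₁ x~y with (f ^ k) x ≟ᴬ a | (f ^ k) x ≟ᴬ b
    ...   | yes refl | _        = inj₂ (inj₁ x~y)
    ...   | no _     | yes refl = inj₂ (inj₂ x~y)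
    ...   | no y≢a   | no y≢b   =
      inj₁ (subst (SameOrbit g x) (sym (trans (f≗g∘swap _) (cong g (swap-other y≢a y≢b))))
                  (Orbits.orbit-step g x~y))

    module _ {n} (code : A → Fin n) (code-injective : Injective _≡_ _≡_ code)
             (f-injective : Injective _≡_ _≡_ f) (g-injective : Injective _≡_ _≡_ g) where

      open FiniteOrbits code code-injective f-injective using () renaming (orbit-sym to f-orbit-sym)
      open FiniteOrbits code code-injective g-injective using (avoid-orbit) renaming (orbit-sym to g-orbit-sym)

      -- Composing with a transposition splits or merges one orbit, so at most one element of W is lost.
      distinctOrbits-swap : ∀ {W} → DistinctOrbits g W →
                            ¬ ¬ (∃[ W′ ] W′ ⊆ W × DistinctOrbits f W′ × length W ≤ suc (length W′))
      distinctOrbits-swap distinct = do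
        W′ , W′⊆W , distinct′ , W′≁a , |W|≤ ← avoid-orbit a distinct
        return (W′ , W′⊆W , separate distinct′ W′≁a , |W|≤)
        where
        f-separate : ∀ {x y} → ¬ SameOrbit g x y → ¬ SameOrbit g x a → ¬ SameOrbit g y a → ¬ SameOrbit f x y
        f-separate x≁y x≁a y≁a x~y with orbit-swap x~y
        ... | inj₁ x~ᵍy = x≁y x~ᵍy
        ... | inj₂ (inj₁ x~a) = x≁a x~a
        ... | inj₂ (inj₂ x~b) with orbit-swap (f-orbit-sym x~y)
        ...   | inj₁ y~x = x≁y (g-orbit-sym y~x)
        ...   | inj₂ (inj₁ y~a) = y≁a y~a
        ...   | inj₂ (inj₂ y~b) = x≁y (Orbits.orbit-trans g x~b (g-orbit-sym y~b))

        separate : ∀ {W} → DistinctOrbits g W → All (λ x → ¬ SameOrbit g x a) W → DistinctOrbits f W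
        separate [] [] = []
        separate (x≁W ∷ distinct) (x≁a ∷ W≁a) =
          All.zipWith (λ (x≁y , y≁a) → f-separate x≁y x≁a y≁a) (x≁W , W≁a) ∷ separate distinct W≁a

  -- Splices r out of its ρ-cycle and fixes it: deleting a dart from a rotation system.
  skip : A → (A → A) → A → A
  skip r ρ x with x ≟ᴬ r
  ... | yes _ = r
  ... | no _ with ρ x ≟ᴬ r
  ...   | yes _ = ρ r
  ...   | no _  = ρ x

  module _ {ρ : A → A} (ρ-injective : Injective _≡_ _≡_ ρ) (r : A) where

    skip-self : skip r ρ r ≡ r
    skip-self with r ≟ᴬ r
    ... | yes _   = refl
    ... | no r≢r = contradiction refl r≢r

    skip-pred : ∀ {x} → ¬ x ≡ r → ρ x ≡ r → skip r ρ x ≡ ρ r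
    skip-pred {x} x≢r ρx≡r with x ≟ᴬ r
    ... | yes x≡r = contradiction x≡r x≢r
    ... | no _ with ρ x ≟ᴬ r
    ...   | yes _    = refl
    ...   | no ρx≢r = contradiction ρx≡r ρx≢r

    skip-other : ∀ {x} → ¬ x ≡ r → ¬ ρ x ≡ r → skip r ρ x ≡ ρ x
    skip-other {x} x≢r ρx≢r with x ≟ᴬ r
    ... | yes x≡r = contradiction x≡r x≢r
    ... | no _ with ρ x ≟ᴬ r
    ...   | yes ρx≡r = contradiction ρx≡r ρx≢r
    ...   | no _     = refl

    skip-fixed : ∀ {x} → ρ x ≡ x → skip r ρ x ≡ x
    skip-fixed {x} ρx≡x with x ≟ᴬ r
    ... | yes x≡r = sym x≡r
    ... | no x≢r with ρ x ≟ᴬ r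
    ...   | yes ρx≡r = contradiction (trans (sym ρx≡x) ρx≡r) x≢r
    ...   | no _     = ρx≡x

    skip-id : ρ r ≡ r → ∀ x → skip r ρ x ≡ ρ x
    skip-id ρr≡r x with x ≟ᴬ r
    ... | yes refl = sym ρr≡r
    ... | no x≢r with ρ x ≟ᴬ r
    ...   | yes ρx≡r = contradiction (ρ-injective (trans ρx≡r (sym ρr≡r))) x≢r
    ...   | no _     = refl

    skip-injective : Injective _≡_ _≡_ (skip r ρ)
    skip-injective {x} {y} eq with x ≟ᴬ r | y ≟ᴬ r
    ... | yes x≡r | yes y≡r = trans x≡r (sym y≡r)
    ... | yes x≡r | no y≢r with ρ y ≟ᴬ r
    ...   | yes ρy≡r = contradiction (ρ-injective (trans ρy≡r eq)) y≢r
    ...   | no ρy≢r  = contradiction (sym eq) ρy≢r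
    skip-injective {x} {y} eq | no x≢r | yes y≡r with ρ x ≟ᴬ r
    ...   | yes ρx≡r = contradiction (ρ-injective (trans ρx≡r (sym eq))) x≢r
    ...   | no ρx≢r  = contradiction eq ρx≢r
    skip-injective {x} {y} eq | no x≢r | no y≢r with ρ x ≟ᴬ r | ρ y ≟ᴬ r
    ...   | yes ρx≡r | yes ρy≡r = ρ-injective (trans ρx≡r (sym ρy≡r))
    ...   | yes _    | no _     = contradiction (sym (ρ-injective eq)) y≢r
    ...   | no _     | yes _    = contradiction (ρ-injective eq) x≢r
    ...   | no _     | no _     = ρ-injective eq

    skip∘swap : ∀ {p} → ρ p ≡ r → ρ ≗ skip r ρ ∘ swap p r
    skip∘swap {p} ρp≡r x with x ≟ᴬ p
    ... | yes refl = trans ρp≡r (sym skip-self)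
    ... | no x≢p with x ≟ᴬ r
    ...   | yes refl = sym (skip-pred (x≢p ∘ sym) ρp≡r)
    ...   | no x≢r   = sym (skip-other x≢r (λ ρx≡r → x≢p (ρ-injective (trans ρx≡r (sym ρp≡r)))))

  swap-conjugate : ∀ {θ : A → A} → θ ∘ θ ≗ id → ∀ a b → swap a b ∘ θ ≗ θ ∘ swap (θ a) (θ b)
  swap-conjugate {θ} θθ a b x with θ x ≟ᴬ a | x ≟ᴬ θ a
  ... | yes _      | yes _      = sym (θθ b)
  ... | yes θx≡a   | no x≢θa    = contradiction (trans (sym (θθ x)) (cong θ θx≡a)) x≢θa
  ... | no θx≢a    | yes x≡θa   = contradiction (trans (cong θ x≡θa) (θθ a)) θx≢a
  ... | no _       | no _ with θ x ≟ᴬ b | x ≟ᴬ θ b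
  ...   | yes _    | yes _      = sym (θθ a)
  ...   | yes θx≡b | no x≢θb    = contradiction (trans (sym (θθ x)) (cong θ θx≡b)) x≢θb
  ...   | no θx≢b  | yes x≡θb   = contradiction (trans (cong θ x≡θb) (θθ b)) θx≢b
  ...   | no _     | no _       = refl

module _ {A : Set} (R : A → A → Set) (R-trans : ∀ {a b c} → R a b → R b c → R a c) {v : A} where

  leg-excluded : ∀ {wᵢ wⱼ wₖ} → ¬ ((R v wᵢ ⊎ R wₖ wᵢ) × (R v wⱼ ⊎ R wₖ wⱼ)) →
                 R v wⱼ ⊎ R wᵢ wⱼ ⊎ R wₖ wⱼ → ¬ (R v wᵢ ⊎ R wₖ wᵢ)
  leg-excluded P (inj₁ v~wⱼ)         wᵢ∈           = P (wᵢ∈ , inj₁ v~wⱼ)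
  leg-excluded P (inj₂ (inj₂ wₖ~wⱼ)) wᵢ∈           = P (wᵢ∈ , inj₂ wₖ~wⱼ)
  leg-excluded P (inj₂ (inj₁ wᵢ~wⱼ)) (inj₁ v~wᵢ)  = P (inj₁ v~wᵢ , inj₁ (R-trans v~wᵢ wᵢ~wⱼ))
  leg-excluded P (inj₂ (inj₁ wᵢ~wⱼ)) (inj₂ wₖ~wᵢ) = P (inj₂ wₖ~wᵢ , inj₂ (R-trans wₖ~wᵢ wᵢ~wⱼ))

  leg-linked : ∀ {wᵢ wⱼ wₖ} → ¬ ((R v wᵢ ⊎ R wₖ wᵢ) × (R v wⱼ ⊎ R wₖ wⱼ)) →
               R v wᵢ ⊎ R wⱼ wᵢ ⊎ R wₖ wᵢ → R v wⱼ ⊎ R wᵢ wⱼ ⊎ R wₖ wⱼ → R wⱼ wᵢ × ¬ R wₖ wᵢ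
  leg-linked P (inj₁ v~wᵢ)         Bⱼ = contradiction (inj₁ v~wᵢ) (leg-excluded P Bⱼ)
  leg-linked P (inj₂ (inj₁ wⱼ~wᵢ)) Bⱼ = wⱼ~wᵢ , leg-excluded P Bⱼ ∘ inj₂
  leg-linked P (inj₂ (inj₂ wₖ~wᵢ)) Bⱼ = contradiction (inj₂ wₖ~wᵢ) (leg-excluded P Bⱼ)

  -- Read R as connectivity after deleting three edges vwᵢ: if deleting any one of them keeps
  -- the graph connected, then deleting one of the pairs {vw₁, vw₂}, {vw₁, vw₃} does too.
  three-legs : ∀ {w₁ w₂ w₃} →
               R v w₁ ⊎ R w₂ w₁ ⊎ R w₃ w₁ → R v w₂ ⊎ R w₁ w₂ ⊎ R w₃ w₂ → R v w₃ ⊎ R w₁ w₃ ⊎ R w₂ w₃ →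
               ¬ ((R v w₁ ⊎ R w₃ w₁) × (R v w₂ ⊎ R w₃ w₂)) → ¬ ((R v w₁ ⊎ R w₂ w₁) × (R v w₃ ⊎ R w₂ w₃)) → ⊥
  three-legs B₁ B₂ B₃ P₁₂ P₁₃ =
    proj₂ (leg-linked P₁₃ (Sum.map₂ Sum.swap B₁) B₃) (proj₁ (leg-linked P₁₂ B₁ B₂))

module Incidence (G : Graph) where

  open Graph G

  VertexSet : Set
  VertexSet = Fin nV → Bool

  EdgeSubset : EdgeSet G → EdgeSet G → Set
  EdgeSubset S S′ = ∀ e → S e ≡ true → S′ e ≡ true

  IsLoop : Fin nE → Set
  IsLoop e = proj₁ (ends e) ≡ proj₂ (ends e)

  Joins-sym : ∀ {e x y} → Joins G e x y → Joins G e y x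
  Joins-sym (inj₁ p) = inj₂ p
  Joins-sym (inj₂ p) = inj₁ p

  Joins-end₂ : ∀ {e x y} → Joins G e x y → IsEnd G y e
  Joins-end₂ (inj₁ p) = inj₂ (cong proj₂ p)
  Joins-end₂ (inj₂ p) = inj₁ (cong proj₁ p)

  Joins-end₁ : ∀ {e x y} → Joins G e x y → IsEnd G x e
  Joins-end₁ = Joins-end₂ ∘ Joins-sym

  Joins-ends : ∀ e → Joins G e (proj₁ (ends e)) (proj₂ (ends e))
  Joins-ends e = inj₁ refl

  Joins-loop : ∀ {e x y} → IsLoop e → Joins G e x y → x ≡ y
  Joins-loop loop (inj₁ p) = trans (sym (cong proj₁ p)) (trans loop (cong proj₂ p))
  Joins-loop loop (inj₂ p) = trans (sym (cong proj₂ p)) (trans (sym loop) (cong proj₁ p))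

  IsEnd-Joins : ∀ {e v w z} → Joins G e v w → IsEnd G z e → z ≡ v ⊎ z ≡ w
  IsEnd-Joins (inj₁ p) (inj₁ q) = inj₁ (trans (sym q) (cong proj₁ p))
  IsEnd-Joins (inj₁ p) (inj₂ q) = inj₂ (trans (sym q) (cong proj₂ p))
  IsEnd-Joins (inj₂ p) (inj₁ q) = inj₂ (trans (sym q) (cong proj₁ p))
  IsEnd-Joins (inj₂ p) (inj₂ q) = inj₁ (trans (sym q) (cong proj₂ p))

  _≟ᴰ_ : DecidableEquality (Dart G)
  _≟ᴰ_ = ≡-dec Fin._≟_ Bool._≟_

  flipDart-involutive : ∀ d → flipDart G (flipDart G d) ≡ d
  flipDart-involutive (e , b) = cong (e ,_) (Bool.not-involutive b)

  flipDart-injective : Injective _≡_ _≡_ (flipDart G)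
  flipDart-injective {d} {d′} eq =
    trans (sym (flipDart-involutive d)) (trans (cong (flipDart G) eq) (flipDart-involutive d′))

  flipDart-≢ : ∀ d → ¬ flipDart G d ≡ d
  flipDart-≢ (e , false) ()
  flipDart-≢ (e , true)  ()

  dartIndex : Dart G → Fin (nE * 2)
  dartIndex (e , false) = combine e zero
  dartIndex (e , true)  = combine e (suc zero)

  dartIndex-injective : Injective _≡_ _≡_ dartIndex
  dartIndex-injective {e , false} {f , false} eq = cong (_, false) (proj₁ (Fin.combine-injective e _ f _ eq))
  dartIndex-injective {e , true}  {f , true}  eq = cong (_, true) (proj₁ (Fin.combine-injective e _ f _ eq))
  dartIndex-injective {e , false} {f , true}  eq with () ← proj₂ (Fin.combine-injective e _ f _ eq)
  dartIndex-injective {e , true}  {f , false} eq with () ← proj₂ (Fin.combine-injective e _ f _ eq)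

  dart-Joins : ∀ d → Joins G (proj₁ d) (dartVertex G d) (dartVertex G (flipDart G d))
  dart-Joins (e , false) = inj₁ refl
  dart-Joins (e , true)  = inj₂ refl

  dart-IsEnd : ∀ d → IsEnd G (dartVertex G d) (proj₁ d)
  dart-IsEnd = Joins-end₁ ∘ dart-Joins

  Joins-dart : ∀ {e x y} → Joins G e x y → ∃[ d ] proj₁ d ≡ e × dartVertex G d ≡ y
  Joins-dart {e} (inj₁ p) = (e , true) , refl , cong proj₂ p
  Joins-dart {e} (inj₂ p) = (e , false) , refl , cong proj₁ p

  loop-flip : ∀ d → IsLoop (proj₁ d) → dartVertex G (flipDart G d) ≡ dartVertex G d
  loop-flip (e , false) loop = sym loop
  loop-flip (e , true)  loop = loop

  flip-loop : ∀ d → dartVertex G (flipDart G d) ≡ dartVertex G d → IsLoop (proj₁ d)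
  flip-loop (e , false) same = sym same
  flip-loop (e , true)  same = same

  same-edge-flip : ∀ {a b} → proj₁ a ≡ proj₁ b → ¬ a ≡ b → b ≡ flipDart G a
  same-edge-flip {e , false} {.e , false} refl a≢b = contradiction refl a≢b
  same-edge-flip {e , false} {.e , true}  refl _   = refl
  same-edge-flip {e , true}  {.e , false} refl _   = refl
  same-edge-flip {e , true}  {.e , true}  refl a≢b = contradiction refl a≢b

module Rotations (G : Graph) where

  open Incidence G
  open Transpositions _≟ᴰ_ public

  faceStep : (Dart G → Dart G) → Dart G → Dart G
  faceStep ρ d = ρ (flipDart G d)

  faceStep-injective : ∀ {ρ} → Injective _≡_ _≡_ ρ → Injective _≡_ _≡_ (faceStep ρ)
  faceStep-injective ρ-injective = flipDart-injective ∘ ρ-injective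

  SameFace : (Dart G → Dart G) → Dart G → Dart G → Set
  SameFace ρ = Orbits.SameOrbit (faceStep ρ)

  DistinctFaces : (Dart G → Dart G) → List (Dart G) → Set
  DistinctFaces ρ = Orbits.DistinctOrbits (faceStep ρ)

  record IsRotationOn (K : Dart G → Set) (ρ : Dart G → Dart G) : Set where
    field
      injective  : Injective _≡_ _≡_ ρ
      closed     : ∀ {d} → K d → K (ρ d)
      local      : ∀ {d} → K d → dartVertex G (ρ d) ≡ dartVertex G d
      transitive : ∀ {d d′} → K d → K d′ → dartVertex G d ≡ dartVertex G d′ → Orbits.SameOrbit ρ d d′

  IsRotationOn-⊆ : ∀ {K K′ ρ} → (∀ {d} → K′ d → K d) → (∀ {d} → K′ d → K′ (ρ d)) →
                   IsRotationOn K ρ → IsRotationOn K′ ρ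
  IsRotationOn-⊆ K′⊆K K′-closed rot = record
    { injective  = injective
    ; closed     = K′-closed
    ; local      = local ∘ K′⊆K
    ; transitive = λ kd kd′ → transitive (K′⊆K kd) (K′⊆K kd′)
    }
    where open IsRotationOn rot

  _-ᴰ_ : (Dart G → Set) → Dart G → Dart G → Set
  (K -ᴰ r) d = K d × ¬ d ≡ r

  module _ {K ρ} (rot : IsRotationOn K ρ) (r : Dart G) where

    open IsRotationOn rot
    open Function.Endo.Propositional (Dart G) using (_^_)
    open Orbits using (^-suc; orbit-refl; orbit-stepˡ)

    skip-closed : ∀ {d} → (K -ᴰ r) d → (K -ᴰ r) (skip r ρ d)
    skip-closed {d} (kd , d≢r) with ρ d ≟ᴰ r
    ... | no ρd≢r = subst (K -ᴰ r) (sym (skip-other injective r d≢r ρd≢r)) (closed kd , ρd≢r)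
    ... | yes ρd≡r = subst (K -ᴰ r) (sym (skip-pred injective r d≢r ρd≡r))
                       (closed (subst K ρd≡r (closed kd)) , λ ρr≡r → d≢r (injective (trans ρd≡r (sym ρr≡r))))

    skip-local : ∀ {d} → (K -ᴰ r) d → dartVertex G (skip r ρ d) ≡ dartVertex G d
    skip-local {d} (kd , d≢r) with ρ d ≟ᴰ r
    ... | no ρd≢r = trans (cong (dartVertex G) (skip-other injective r d≢r ρd≢r)) (local kd)
    ... | yes ρd≡r = trans (cong (dartVertex G) (skip-pred injective r d≢r ρd≡r))
                       (trans (local (subst K ρd≡r (closed kd))) (trans (cong (dartVertex G) (sym ρd≡r)) (local kd)))

    -- A ρ-path between darts other than r is shortened by skip r ρ by at most one step, at r.
    skip-orbit : ∀ k {d} → (K -ᴰ r) d → (K -ᴰ r) ((ρ ^ k) d) → Orbits.SameOrbit (skip r ρ) d ((ρ ^ k) d)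
    skip-orbit zero    {d} _ _ = orbit-refl (skip r ρ) d
    skip-orbit (suc k) {d} (kd , d≢r) end with ρ d ≟ᴰ r
    ... | no ρd≢r = orbit-stepˡ (skip r ρ) (subst₂ (Orbits.SameOrbit (skip r ρ))
                      (sym (skip-other injective r d≢r ρd≢r)) (sym (^-suc ρ k d))
                      (skip-orbit k (closed kd , ρd≢r) (subst (K -ᴰ r) (^-suc ρ k d) end)))
    skip-orbit (suc zero) {d} _ (_ , ρd≢r) | yes ρd≡r = contradiction ρd≡r ρd≢r
    skip-orbit (suc (suc k)) {d} (kd , d≢r) end | yes ρd≡r =
      orbit-stepˡ (skip r ρ) (subst₂ (Orbits.SameOrbit (skip r ρ)) (sym (skip-pred injective r d≢r ρd≡r)) (sym path)
        (skip-orbit k (closed kr , ρr≢r) (subst (K -ᴰ r) path end)))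
      where
      kr : K r
      kr = subst K ρd≡r (closed kd)
      ρr≢r : ¬ ρ r ≡ r
      ρr≢r ρr≡r = d≢r (injective (trans ρd≡r (sym ρr≡r)))
      path : (ρ ^ suc (suc k)) d ≡ (ρ ^ k) (ρ r)
      path = trans (^-suc ρ (suc k) d) (trans (cong (ρ ^ suc k) ρd≡r) (^-suc ρ k r))

    skip-rotation : IsRotationOn (K -ᴰ r) (skip r ρ)
    skip-rotation = record
      { injective  = skip-injective injective r
      ; closed     = skip-closed
      ; local      = skip-local
      ; transitive = λ kd kd′ same-vertex → transit kd kd′ (transitive (proj₁ kd) (proj₁ kd′) same-vertex)
      }
      where
      transit : ∀ {d d′} → (K -ᴰ r) d → (K -ᴰ r) d′ → Orbits.SameOrbit ρ d d′ → Orbits.SameOrbit (skip r ρ) d d′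
      transit kd kd′ (k , refl) = skip-orbit k kd kd′

  module _ {ρ : Dart G → Dart G} (ρ-injective : Injective _≡_ _≡_ ρ) (r : Dart G) where

    open FiniteOrbits dartIndex dartIndex-injective ρ-injective using (preimage)

    faceStep-skip : ∀ {p} → ρ p ≡ r → faceStep ρ ≗ faceStep (skip r ρ) ∘ swap (flipDart G p) (flipDart G r)
    faceStep-skip ρp≡r d = trans (skip∘swap ρ-injective r ρp≡r (flipDart G d))
                                 (cong (skip r ρ) (swap-conjugate {flipDart G} flipDart-involutive _ _ d))

    skip-faces : ∀ {W} → DistinctFaces (skip r ρ) W →
                 ¬ ¬ (∃[ W′ ] W′ ⊆ W × DistinctFaces ρ W′ × length W ≤ suc (length W′))
    skip-faces with preimage r
    ... | p , ρp≡r = distinctOrbits-swap (faceStep-skip ρp≡r) dartIndex dartIndex-injective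
                       (faceStep-injective ρ-injective) (faceStep-injective (skip-injective ρ-injective r))

    skip-faces-fixed : ρ r ≡ r → ∀ {W} → DistinctFaces (skip r ρ) W → DistinctFaces ρ W
    skip-faces-fixed ρr≡r = distinctOrbits-cong (λ d → skip-id ρ-injective r ρr≡r (flipDart G d))

    skip-faces-bit : ∀ c → (c ≡ false → ρ r ≡ r) → ∀ {W} → DistinctFaces (skip r ρ) W →
                     ¬ ¬ (∃[ W′ ] W′ ⊆ W × DistinctFaces ρ W′ × length W ≤ length W′ + Counting.bit c)
    skip-faces-bit false fixed {W} distinct =
      return (W , ⊆-refl , skip-faces-fixed (fixed refl) distinct , ≤-reflexive (sym (+-identityʳ _)))
    skip-faces-bit true _ distinct = do
      W′ , W′⊆W , distinct′ , |W|≤ ← skip-faces distinct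
      return (W′ , W′⊆W , distinct′ , ≤-trans |W|≤ (≤-reflexive (+-comm 1 _)))

  skipAll : List (Dart G) → (Dart G → Dart G) → Dart G → Dart G
  skipAll []      ρ = ρ
  skipAll (r ∷ R) ρ = skip r (skipAll R ρ)

  skipAll-injective : ∀ {ρ} → Injective _≡_ _≡_ ρ → ∀ R → Injective _≡_ _≡_ (skipAll R ρ)
  skipAll-injective ρ-injective []      = ρ-injective
  skipAll-injective ρ-injective (r ∷ R) = skip-injective (skipAll-injective ρ-injective R) r

  skipAll-fixed : ∀ {ρ} → Injective _≡_ _≡_ ρ → ∀ R {d} → d ∈ R → skipAll R ρ d ≡ d
  skipAll-fixed ρ-injective (r ∷ R) (here refl) = skip-self (skipAll-injective ρ-injective R) r
  skipAll-fixed ρ-injective (r ∷ R) (there d∈R) =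
    skip-fixed (skipAll-injective ρ-injective R) r (skipAll-fixed ρ-injective R d∈R)

  skipAll-faces : ∀ {ρ} → Injective _≡_ _≡_ ρ → ∀ R {W} → DistinctFaces (skipAll R ρ) W →
                  ¬ ¬ (∃[ W′ ] DistinctFaces ρ W′ × length W ≤ length W′ + length R)
  skipAll-faces ρ-injective [] {W} distinct = return (W , distinct , ≤-reflexive (sym (+-identityʳ _)))
  skipAll-faces ρ-injective (r ∷ R) distinct = do
    W₁ , _ , distinct₁ , |W|≤ ← skip-faces (skipAll-injective ρ-injective R) r distinct
    W₂ , distinct₂ , |W₁|≤ ← skipAll-faces ρ-injective R distinct₁
    return (W₂ , distinct₂ , ≤-trans |W|≤ (≤-trans (s≤s |W₁|≤) (≤-reflexive (sym (+-suc _ _)))))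

  _-ᴸ_ : (Dart G → Set) → List (Dart G) → Dart G → Set
  (K -ᴸ R) d = K d × ¬ d ∈ R

  skipAll-rotation : ∀ {K ρ} R → IsRotationOn K ρ → IsRotationOn (K -ᴸ R) (skipAll R ρ)
  skipAll-rotation [] rot = IsRotationOn-⊆ proj₁ (λ (kd , _) → IsRotationOn.closed rot kd , λ ()) rot
  skipAll-rotation {K} (r ∷ R) rot = IsRotationOn-⊆ from (to ∘ IsRotationOn.closed rot′ ∘ from) rot′
    where
    rot′ = skip-rotation (skipAll-rotation R rot) r
    to : ∀ {d} → ((K -ᴸ R) -ᴰ r) d → (K -ᴸ (r ∷ R)) d
    to ((kd , d∉R) , d≢r) = kd , λ { (here d≡r) → d≢r d≡r ; (there d∈R) → d∉R d∈R }
    from : ∀ {d} → (K -ᴸ (r ∷ R)) d → ((K -ᴸ R) -ᴰ r) d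
    from (kd , d∉r∷R) = (kd , d∉r∷R ∘ there) , d∉r∷R ∘ here

module Reachability (G : Graph) where

  open Graph G
  open Incidence G

  reach-edge : ∀ {S x y} e → S e ≡ true → Joins G e x y → Reach G S x y
  reach-edge e Se j = step e Se j here

  reach-trans : ∀ {S u x y} → Reach G S u x → Reach G S x y → Reach G S u y
  reach-trans r here                = r
  reach-trans r (step e Se j r′)    = step e Se j (reach-trans r r′)

  reach-sym : ∀ {S u v} → Reach G S u v → Reach G S v u
  reach-sym here             = here
  reach-sym (step e Se j r)  = reach-trans (reach-edge e Se (Joins-sym j)) (reach-sym r)

  reach-mono : ∀ {S S′ u v} → EdgeSubset S S′ → Reach G S u v → Reach G S′ u v
  reach-mono S⊆S′ here            = here
  reach-mono S⊆S′ (step e Se j r) = step e (S⊆S′ e Se) j (reach-mono S⊆S′ r)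

  reach-lastExit : ∀ S S′ {u x} → Reach G S u x →
                   Reach G S′ u x ⊎ ∃[ e ] S e ≡ true × S′ e ≡ false × ∃[ z ] IsEnd G z e × Reach G S′ z x
  reach-lastExit S S′ here = inj₁ here
  reach-lastExit S S′ (step e Se j r) with S′ e in S′e
  ... | false = inj₂ (e , Se , S′e , _ , Joins-end₂ j , here)
  ... | true with reach-lastExit S S′ r
  ...   | inj₁ r′                        = inj₁ (step e S′e j r′)
  ...   | inj₂ (e′ , Se′ , S′e′ , z , z∈e′ , r′) = inj₂ (e′ , Se′ , S′e′ , z , z∈e′ , step e S′e j r′)

  reach-invariant : ∀ S S′ (Q : Fin nV → Set) →
                    (∀ {e a b} → S e ≡ true → Joins G e a b → Q a → Q b × S′ e ≡ true) →
                    ∀ {u x} → Q u → Reach G S u x → Reach G S′ u x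
  reach-invariant S S′ Q preserved Qu r = proj₁ (go r)
    where
    go : ∀ {x} → Reach G S _ x → Reach G S′ _ x × Q x
    go here = here , Qu
    go (step e Se j r) with go r
    ... | r′ , Qa = step e (proj₂ (preserved Se j Qa)) j r′ , proj₁ (preserved Se j Qa)

  reach-loops : ∀ S S′ → (∀ e → S e ≡ true → S′ e ≡ false → IsLoop e) →
                ∀ {u x} → Reach G S u x → Reach G S′ u x
  reach-loops S S′ loops here = here
  reach-loops S S′ loops (step e Se j r) with S′ e in S′e
  ... | true  = step e S′e j (reach-loops S S′ loops r)
  ... | false = subst (Reach G S′ _) (Joins-loop (loops e Se S′e) j) (reach-loops S S′ loops r)

  Connects : EdgeSet G → VertexSet → Set
  Connects S V = ∀ u w → V u ≡ true → V w ≡ true → Reach G S u w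

  connects-from : ∀ {S V} v → (∀ x → V x ≡ true → Reach G S v x) → Connects S V
  connects-from v reach u w Vu Vw = reach-trans (reach-sym (reach u Vu)) (reach w Vw)

  EdgesWithin : EdgeSet G → VertexSet → Set
  EdgesWithin S V = ∀ e → S e ≡ true → V (proj₁ (ends e)) ≡ true × V (proj₂ (ends e)) ≡ true

  NoRemovablePair : EdgeSet G → VertexSet → Set
  NoRemovablePair S V = ∀ e f → S e ≡ true → S f ≡ true → Adjacent G e f → ¬ Connects (removePair G S e f) V

  module _ (S : EdgeSet G) (e f : Fin nE) where

    removePair⁻ : ∀ {x} → removePair G S e f x ≡ true → S x ≡ true × ¬ x ≡ e × ¬ x ≡ f
    removePair⁻ {x} kept with S x | x ≟ e | x ≟ f
    ... | true | no x≢e | no x≢f = refl , x≢e , x≢f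

    removePair⁺ : ∀ {x} → S x ≡ true → ¬ x ≡ e → ¬ x ≡ f → removePair G S e f x ≡ true
    removePair⁺ {x} Sx x≢e x≢f with S x | x ≟ e | x ≟ f
    ... | true | no _    | no _    = refl
    ... | _    | yes x≡e | _       = contradiction x≡e x≢e
    ... | _    | no _    | yes x≡f = contradiction x≡f x≢f

    removePair-⊆ : EdgeSubset (removePair G S e f) S
    removePair-⊆ x = proj₁ ∘ removePair⁻

    removePair-removed : ∀ {x} → S x ≡ true → removePair G S e f x ≡ false → x ≡ e ⊎ x ≡ f
    removePair-removed {x} Sx removed with S x | x ≟ e | x ≟ f
    ... | _     | yes x≡e | _       = inj₁ x≡e
    ... | _     | no _    | yes x≡f = inj₂ x≡f
    ... | true  | no _    | no _    with () ← removed
    ... | false | no _    | no _    with () ← Sx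

  removePair-sym : ∀ {S e f} → EdgeSubset (removePair G S e f) (removePair G S f e)
  removePair-sym {S} {e} {f} x kept with removePair⁻ S e f kept
  ... | Sx , x≢e , x≢f = removePair⁺ S f e Sx x≢f x≢e

  Joins-within : ∀ {S V e x y} → EdgesWithin S V → S e ≡ true → Joins G e x y → V x ≡ true × V y ≡ true
  Joins-within within Se (inj₁ refl) = within _ Se
  Joins-within within Se (inj₂ refl) = Data.Product.swap (within _ Se)

module Subgraphs (G : Graph) where

  open Graph G
  open Incidence G
  open Rotations G
  open Reachability G
  open Counting

  InSub : EdgeSet G → Dart G → Set
  InSub S d = S (proj₁ d) ≡ true

  hasEdge? : ∀ (S : EdgeSet G) → Dec (∃[ e ] S e ≡ true)
  hasEdge? S = Fin.any? {P = λ e → S e ≡ true} (λ e → S e Bool.≟ true)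

  hasEdge : EdgeSet G → Bool
  hasEdge S = ⌊ hasEdge? S ⌋

  hasEdge-true : ∀ {S : EdgeSet G} {e} → S e ≡ true → hasEdge S ≡ true
  hasEdge-true {S} {e} Se with hasEdge? S
  ... | yes _   = refl
  ... | no none = contradiction (e , Se) none

  hasEdge-false : ∀ {S : EdgeSet G} → (∀ e → ¬ S e ≡ true) → hasEdge S ≡ false
  hasEdge-false {S} none with hasEdge? S
  ... | yes (e , Se) = contradiction Se (none e)
  ... | no _         = refl

  removeEdge : EdgeSet G → Fin nE → EdgeSet G
  removeEdge S e = removePair G S e e

  removeEdge-self : ∀ S e → ¬ removeEdge S e e ≡ true
  removeEdge-self S e kept = proj₁ (proj₂ (removePair⁻ S e e kept)) refl

  record IsConnectedOn (S : EdgeSet G) (V : VertexSet) : Set where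
    field
      within    : EdgesWithin S V
      connects  : Connects S V
      inhabited : ∃[ v ] V v ≡ true

  -- The faces witness genus 0: at least E − V + 2 of them, or E − V + 1 when there is
  -- no edge (an edgeless graph has no darts to trace its single face).
  record PlanarWitness (S : EdgeSet G) (V : VertexSet) (ρ : Dart G → Dart G) : Set where
    field
      faces    : List (Dart G)
      distinct : DistinctFaces ρ faces
      on-S     : All (InSub S) faces
      bound    : count S + 1 + bit (hasEdge S) ≤ length faces + count V

module ThreeEdges (G : Graph) where

  open Graph G
  open Incidence G
  open Reachability G
  open Subgraphs G

  module _ {S V} (connects : Connects S V) (within : EdgesWithin S V) (noPair : NoRemovablePair S V)
           {v w₁ w₂ w₃ e₁ e₂ e₃} (j₁ : Joins G e₁ v w₁) (j₂ : Joins G e₂ v w₂) (j₃ : Joins G e₃ v w₃)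
           (S₁ : S e₁ ≡ true) (S₂ : S e₂ ≡ true) (S₃ : S e₃ ≡ true)
           (e₁≢e₂ : ¬ e₁ ≡ e₂) (e₁≢e₃ : ¬ e₁ ≡ e₃) (e₂≢e₃ : ¬ e₂ ≡ e₃) where

    S∖₃ : EdgeSet G
    S∖₃ = removePair G (removePair G S e₁ e₂) e₃ e₃

    R : Fin nV → Fin nV → Set
    R = Reach G S∖₃

    S∖₃⁻ : ∀ {e} → S∖₃ e ≡ true → S e ≡ true × ¬ e ≡ e₁ × ¬ e ≡ e₂ × ¬ e ≡ e₃
    S∖₃⁻ kept with removePair⁻ (removePair G S e₁ e₂) e₃ e₃ kept
    ... | kept′ , e≢e₃ , _ with removePair⁻ S e₁ e₂ kept′
    ...   | Se , e≢e₁ , e≢e₂ = Se , e≢e₁ , e≢e₂ , e≢e₃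

    S∖₃-cut : ∀ {e} → S e ≡ true → S∖₃ e ≡ false → e ≡ e₁ ⊎ e ≡ e₂ ⊎ e ≡ e₃
    S∖₃-cut {e} Se cut = by-inner (removePair G S e₁ e₂ e) refl
      where
      by-inner : ∀ b → removePair G S e₁ e₂ e ≡ b → e ≡ e₁ ⊎ e ≡ e₂ ⊎ e ≡ e₃
      by-inner false cut₁₂ = Sum.map₂ inj₁ (removePair-removed S e₁ e₂ Se cut₁₂)
      by-inner true  kept  = inj₂ (inj₂ (Sum.reduce (removePair-removed (removePair G S e₁ e₂) e₃ e₃ kept cut)))

    v∈V : V v ≡ true
    v∈V = proj₁ (Joins-within {V = V} within S₁ j₁)

    w∈V : ∀ {e w} → S e ≡ true → Joins G e v w → V w ≡ true
    w∈V Se j = proj₂ (Joins-within {V = V} within Se j)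

    through : ∀ {P : Set} {e w z x} → Joins G e v w → P → IsEnd G z e → R z x → R v x ⊎ (P × R w x)
    through j p z∈e r with IsEnd-Joins j z∈e
    ... | inj₁ refl = inj₁ r
    ... | inj₂ refl = inj₂ (p , r)

    classify : ∀ {T x} → EdgeSubset T S → Reach G T v x →
               R v x ⊎ (T e₁ ≡ true × R w₁ x) ⊎ (T e₂ ≡ true × R w₂ x) ⊎ (T e₃ ≡ true × R w₃ x)
    classify {T} T⊆S r with reach-lastExit T S∖₃ r
    ... | inj₁ r′ = inj₁ r′
    ... | inj₂ (e , Te , cut , z , z∈e , r′) with S∖₃-cut (T⊆S e Te) cut
    ...   | inj₁ refl        = Sum.map₂ inj₁ (through j₁ Te z∈e r′)
    ...   | inj₂ (inj₁ refl) = Sum.map₂ (inj₂ ∘ inj₁) (through j₂ Te z∈e r′)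
    ...   | inj₂ (inj₂ refl) = Sum.map₂ (inj₂ ∘ inj₂) (through j₃ Te z∈e r′)

    leg₁ : Connects (removeEdge S e₁) V → R v w₁ ⊎ R w₂ w₁ ⊎ R w₃ w₁
    leg₁ c with classify (removePair-⊆ S e₁ e₁) (c v w₁ v∈V (w∈V S₁ j₁))
    ... | inj₁ r                     = inj₁ r
    ... | inj₂ (inj₁ (kept , _))     = contradiction kept (removeEdge-self S _)
    ... | inj₂ (inj₂ (inj₁ (_ , r))) = inj₂ (inj₁ r)
    ... | inj₂ (inj₂ (inj₂ (_ , r))) = inj₂ (inj₂ r)

    leg₂ : Connects (removeEdge S e₂) V → R v w₂ ⊎ R w₁ w₂ ⊎ R w₃ w₂
    leg₂ c with classify (removePair-⊆ S e₂ e₂) (c v w₂ v∈V (w∈V S₂ j₂))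
    ... | inj₁ r                     = inj₁ r
    ... | inj₂ (inj₁ (_ , r))        = inj₂ (inj₁ r)
    ... | inj₂ (inj₂ (inj₁ (kept , _))) = contradiction kept (removeEdge-self S _)
    ... | inj₂ (inj₂ (inj₂ (_ , r))) = inj₂ (inj₂ r)

    leg₃ : Connects (removeEdge S e₃) V → R v w₃ ⊎ R w₁ w₃ ⊎ R w₂ w₃
    leg₃ c with classify (removePair-⊆ S e₃ e₃) (c v w₃ v∈V (w∈V S₃ j₃))
    ... | inj₁ r                     = inj₁ r
    ... | inj₂ (inj₁ (_ , r))        = inj₂ (inj₁ r)
    ... | inj₂ (inj₂ (inj₁ (_ , r))) = inj₂ (inj₂ r)
    ... | inj₂ (inj₂ (inj₂ (kept , _))) = contradiction kept (removeEdge-self S _)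

    connects-if : ∀ {T} → EdgeSubset S∖₃ T → Reach G T v w₁ → Reach G T v w₂ → Reach G T v w₃ → Connects T V
    connects-if S∖₃⊆T r₁ r₂ r₃ = connects-from v reach
      where
      reach : ∀ x → V x ≡ true → Reach G _ v x
      reach x x∈V with classify (λ _ Se → Se) (connects v x v∈V x∈V)
      ... | inj₁ r                     = reach-mono S∖₃⊆T r
      ... | inj₂ (inj₁ (_ , r))        = reach-trans r₁ (reach-mono S∖₃⊆T r)
      ... | inj₂ (inj₂ (inj₁ (_ , r))) = reach-trans r₂ (reach-mono S∖₃⊆T r)
      ... | inj₂ (inj₂ (inj₂ (_ , r))) = reach-trans r₃ (reach-mono S∖₃⊆T r)

    via-leg : ∀ {T w wₖ} → EdgeSubset S∖₃ T → Reach G T v wₖ → R v w ⊎ R wₖ w → Reach G T v w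
    via-leg S∖₃⊆T rₖ (inj₁ r) = reach-mono S∖₃⊆T r
    via-leg S∖₃⊆T rₖ (inj₂ r) = reach-trans rₖ (reach-mono S∖₃⊆T r)

    pair₁₂ : ¬ ((R v w₁ ⊎ R w₃ w₁) × (R v w₂ ⊎ R w₃ w₂))
    pair₁₂ (x₁ , x₂) = noPair e₁ e₂ S₁ S₂ (e₁≢e₂ , v , Joins-end₁ j₁ , Joins-end₁ j₂)
                         (connects-if ⊆T (via-leg ⊆T r₃ x₁) (via-leg ⊆T r₃ x₂) r₃)
      where
      ⊆T : EdgeSubset S∖₃ (removePair G S e₁ e₂)
      ⊆T e kept = let Se , e≢e₁ , e≢e₂ , _ = S∖₃⁻ kept in removePair⁺ S e₁ e₂ Se e≢e₁ e≢e₂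
      r₃ = reach-edge e₃ (removePair⁺ S e₁ e₂ S₃ (e₁≢e₃ ∘ sym) (e₂≢e₃ ∘ sym)) j₃

    pair₁₃ : ¬ ((R v w₁ ⊎ R w₂ w₁) × (R v w₃ ⊎ R w₂ w₃))
    pair₁₃ (x₁ , x₃) = noPair e₁ e₃ S₁ S₃ (e₁≢e₃ , v , Joins-end₁ j₁ , Joins-end₁ j₃)
                         (connects-if ⊆T (via-leg ⊆T r₂ x₁) r₂ (via-leg ⊆T r₂ x₃))
      where
      ⊆T : EdgeSubset S∖₃ (removePair G S e₁ e₃)
      ⊆T e kept = let Se , e≢e₁ , _ , e≢e₃ = S∖₃⁻ kept in removePair⁺ S e₁ e₃ Se e≢e₁ e≢e₃
      r₂ = reach-edge e₂ (removePair⁺ S e₁ e₃ S₂ (e₁≢e₂ ∘ sym) e₂≢e₃) j₂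

    no-three-edges : Connects (removeEdge S e₁) V → Connects (removeEdge S e₂) V →
                     Connects (removeEdge S e₃) V → ⊥
    no-three-edges c₁ c₂ c₃ = three-legs R reach-trans (leg₁ c₁) (leg₂ c₂) (leg₃ c₃) pair₁₂ pair₁₃

module Degrees (G : Graph) where

  open Graph G
  open Incidence G
  open Counting

  dartSum : (Dart G → ℕ) → ℕ
  dartSum h = sum (λ e → h (e , false) + h (e , true))

  dartSum-mono-≤ : ∀ {h k} → (∀ d → h d ≤ k d) → dartSum h ≤ dartSum k
  dartSum-mono-≤ h≤k = sum-mono-≤ (λ e → +-mono-≤ (h≤k (e , false)) (h≤k (e , true)))

  dartSum-+ : ∀ h k → dartSum (λ d → h d + k d) ≡ dartSum h + dartSum k
  dartSum-+ h k = trans (sum-cong-≗ λ e → interchange (h (e , false)) (k (e , false)) (h (e , true)) (k (e , true)))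
                        (∑-distrib-+ (λ e → h (e , false) + h (e , true)) (λ e → k (e , false) + k (e , true)))

  dartSum-zero : dartSum (λ _ → 0) ≡ 0
  dartSum-zero = sum-replicate-zero nE

  dartSum-indicator : ∀ a → dartSum (λ d → bit ⌊ d ≟ᴰ a ⌋) ≡ 1
  dartSum-indicator (e₀ , β) = trans (sum-cong-≗ (darts-of β)) (count-singleton e₀)
    where
    darts-of : ∀ β e → bit ⌊ (e , false) ≟ᴰ (e₀ , β) ⌋ + bit ⌊ (e , true) ≟ᴰ (e₀ , β) ⌋ ≡ bit ⌊ e ≟ e₀ ⌋
    darts-of β e with e ≟ e₀
    darts-of false e | yes refl = refl
    darts-of true  e | yes refl = refl
    darts-of β     e | no _     = refl

  degree : EdgeSet G → Fin nV → ℕ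
  degree S v = dartSum (λ d → bit (S (proj₁ d) ∧ ⌊ v ≟ dartVertex G d ⌋))

  handshake : ∀ S → sum (degree S) ≡ count S + count S
  handshake S = begin
    sum (λ v → sum (λ e → end v e (proj₁ (ends e)) + end v e (proj₂ (ends e))))
      ≡⟨ ∑-comm (λ v e → end v e (proj₁ (ends e)) + end v e (proj₂ (ends e))) ⟩
    sum (λ e → sum (λ v → end v e (proj₁ (ends e)) + end v e (proj₂ (ends e))))
      ≡⟨ sum-cong-≗ (λ e → trans (∑-distrib-+ (λ v → end v e (proj₁ (ends e))) (λ v → end v e (proj₂ (ends e))))
                                 (cong₂ _+_ (ends-once e _) (ends-once e _))) ⟩
    sum (λ e → bit (S e) + bit (S e))
      ≡⟨ ∑-distrib-+ (bit ∘ S) (bit ∘ S) ⟩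
    count S + count S ∎
    where
    open ≡-Reasoning
    end : Fin nV → Fin nE → Fin nV → ℕ
    end v e w = bit (S e ∧ ⌊ v ≟ w ⌋)
    ends-once : ∀ e w → sum (λ v → end v e w) ≡ bit (S e)
    ends-once e w with S e
    ... | true  = count-singleton w
    ... | false = count-false (λ v → false ∧ ⌊ v ≟ w ⌋) (λ _ → refl)

double-cancel-≤ : ∀ {m n} → m + m ≤ n + n → m ≤ n
double-cancel-≤ {m} {n} 2m≤2n with m ≤? n
... | yes m≤n = m≤n
... | no m≰n  = contradiction 2m≤2n (<⇒≱ (+-mono-< (≰⇒> m≰n) (≰⇒> m≰n)))

module Bridgeless (G : Graph) where

  open Graph G
  open Incidence G
  open Counting
  open Rotations G
  open Reachability G
  open Subgraphs G
  open Degrees G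
  open Function.Endo.Propositional (Dart G) using (_^_)

  module _ {S V ρ} (rot : IsRotationOn (InSub S) ρ) (conn : IsConnectedOn S V) (noPair : NoRemovablePair S V)
           (bridgeless : ∀ {e} → S e ≡ true → ¬ ¬ Connects (removeEdge S e) V) where

    open IsRotationOn rot
    open IsConnectedOn conn

    dart∈V : ∀ {d} → InSub S d → V (dartVertex G d) ≡ true
    dart∈V {d} Sd = proj₁ (Joins-within {V = V} within Sd (dart-Joins d))

    another-dart : ∀ {a} → InSub S a → ¬ ¬ (∃[ b ] InSub S b × dartVertex G b ≡ dartVertex G a × ¬ b ≡ a)
    another-dart {a} Sa with proj₁ (ends (proj₁ a)) ≟ proj₂ (ends (proj₁ a))
    ... | yes loop = return (flipDart G a , Sa , loop-flip a loop , flipDart-≢ a)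
    ... | no ¬loop = do
      connected ← bridgeless Sa
      return (last-edge (connected _ _ (dart∈V {flipDart G a} Sa) (dart∈V {a} Sa)) (¬loop ∘ flip-loop a))
      where
      last-edge : ∀ {x} → Reach G (removeEdge S (proj₁ a)) x (dartVertex G a) → ¬ x ≡ dartVertex G a →
                  ∃[ b ] InSub S b × dartVertex G b ≡ dartVertex G a × ¬ b ≡ a
      last-edge here                 x≢x = contradiction refl x≢x
      last-edge (step f kept j _) _ with Joins-dart j | removePair⁻ S (proj₁ a) (proj₁ a) kept
      ... | b , b∈f , vb | Sf , f≢a , _ =
        b , subst (λ e → S e ≡ true) (sym b∈f) Sf , vb , λ b≡a → f≢a (trans (sym b∈f) (cong proj₁ b≡a))

    ρ-no-fixed : ∀ {a} → InSub S a → ¬ ρ a ≡ a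
    ρ-no-fixed {a} Sa ρa≡a = another-dart Sa λ (b , Sb , vb , b≢a) →
      b≢a (Orbits.orbit-closed ρ {P = _≡ a} (λ x≡a → trans (cong ρ x≡a) ρa≡a) (transitive Sa Sb (sym vb)) refl)

    same-edge-loop : ∀ {a b} → proj₁ a ≡ proj₁ b → ¬ a ≡ b → dartVertex G b ≡ dartVertex G a → IsLoop (proj₁ a)
    same-edge-loop {a} a~b a≢b vb = flip-loop a (trans (cong (dartVertex G) (sym (same-edge-flip a~b a≢b))) vb)

    loop-and-edge : ∀ {ℓ f v} → S ℓ ≡ true → S f ≡ true → ¬ ℓ ≡ f → IsLoop ℓ → IsEnd G v ℓ → IsEnd G v f → ¬ ¬ ⊥
    loop-and-edge {ℓ} {f} {v} Sℓ Sf ℓ≢f loop v∈ℓ v∈f = do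
      connected ← bridgeless Sf
      return (noPair ℓ f Sℓ Sf (ℓ≢f , v , v∈ℓ , v∈f)
                λ u w Vu Vw → reach-loops (removeEdge S f) (removePair G S ℓ f) only-loop (connected u w Vu Vw))
      where
      only-loop : ∀ e → removeEdge S f e ≡ true → removePair G S ℓ f e ≡ false → IsLoop e
      only-loop e kept cut with removePair⁻ S f f kept
      ... | Se , e≢f , _ with removePair-removed S ℓ f Se cut
      ...   | inj₁ refl = loop
      ...   | inj₂ e≡f  = contradiction e≡f e≢f

    end-at : ∀ d {v} → dartVertex G d ≡ v → IsEnd G v (proj₁ d)
    end-at d refl = dart-IsEnd d

    no-three-darts : ∀ {a b c} → InSub S a → InSub S b → InSub S c →
                     dartVertex G b ≡ dartVertex G a → dartVertex G c ≡ dartVertex G a →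
                     ¬ a ≡ b → ¬ b ≡ c → ¬ a ≡ c → ¬ ¬ ⊥
    no-three-darts {a} {b} {c} Sa Sb Sc vb vc a≢b b≢c a≢c
      with proj₁ a ≟ proj₁ b | proj₁ a ≟ proj₁ c | proj₁ b ≟ proj₁ c
    ... | yes a~b | yes a~c | _ =
      return (b≢c (trans (same-edge-flip a~b a≢b) (sym (same-edge-flip a~c a≢c))))
    ... | yes a~b | no a≁c | _ =
      loop-and-edge Sa Sc a≁c (same-edge-loop a~b a≢b vb) (dart-IsEnd a) (end-at c vc)
    ... | no a≁b | yes a~c | _ =
      loop-and-edge Sa Sb a≁b (same-edge-loop a~c a≢c vc) (dart-IsEnd a) (end-at b vb)
    ... | no a≁b | no a≁c | yes b~c =
      loop-and-edge Sb Sa (a≁b ∘ sym) (same-edge-loop b~c b≢c (trans vc (sym vb))) (end-at b vb) (dart-IsEnd a)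
    ... | no a≁b | no a≁c | no b≁c = do
      c₁ ← bridgeless Sa
      c₂ ← bridgeless Sb
      c₃ ← bridgeless Sc
      return (ThreeEdges.no-three-edges G connects within noPair (dart-Joins a) (at b vb) (at c vc)
                Sa Sb Sc a≁b a≁c b≁c c₁ c₂ c₃)
      where
      at : ∀ d → dartVertex G d ≡ dartVertex G a → Joins G (proj₁ d) (dartVertex G a) (dartVertex G (flipDart G d))
      at d vd = subst (λ x → Joins G (proj₁ d) x _) vd (dart-Joins d)

    at-most-two : ∀ {a d} → InSub S a → InSub S d → dartVertex G d ≡ dartVertex G a → d ≡ a ⊎ d ≡ ρ a
    at-most-two {a} {d} Sa Sd vd with d ≟ᴰ a | d ≟ᴰ ρ a
    ... | yes d≡a | _        = inj₁ d≡a
    ... | no _    | yes d≡ρa = inj₂ d≡ρa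
    ... | no d≢a  | no d≢ρa  = ⊥-elim (no-three-darts {a} {ρ a} {d} Sa (closed Sa) Sd (local Sa) vd
                                  (ρ-no-fixed Sa ∘ sym) (d≢ρa ∘ sym) (d≢a ∘ sym) id)

    ρ-involutive : ∀ {a} → InSub S a → ρ (ρ a) ≡ a
    ρ-involutive {a} Sa with at-most-two {ρ a} {a} (closed Sa) Sa (sym (local Sa))
    ... | inj₁ a≡ρa  = contradiction (sym a≡ρa) (ρ-no-fixed Sa)
    ... | inj₂ a≡ρρa = sym a≡ρρa

    degree-bound : ∀ v → degree S v ≤ bit (V v) + bit (V v)
    degree-bound v = decidable-stable (_ ≤? _) do
      yes (a , Sa , va) ← ¬¬-excluded-middle {A = ∃[ a ] InSub S a × dartVertex G a ≡ v}
        where no none → return (≤-trans (dartSum-mono-≤ (no-dart none)) (≤-trans (≤-reflexive dartSum-zero) z≤n))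
      return (≤-trans (dartSum-mono-≤ (two-darts Sa va))
               (≤-reflexive (trans (dartSum-+ (λ d → bit ⌊ d ≟ᴰ a ⌋) (λ d → bit ⌊ d ≟ᴰ ρ a ⌋))
                 (trans (cong₂ _+_ (dartSum-indicator a) (dartSum-indicator (ρ a)))
                        (cong (λ b → bit b + bit b) (sym (subst (λ x → V x ≡ true) va (dart∈V {a} Sa))))))))
      where
      no-dart : ¬ (∃[ a ] InSub S a × dartVertex G a ≡ v) → ∀ d → bit (S (proj₁ d) ∧ ⌊ v ≟ dartVertex G d ⌋) ≤ 0
      no-dart none d with S (proj₁ d) in Sd | v ≟ dartVertex G d
      ... | false | _      = z≤n
      ... | true  | no _   = z≤n
      ... | true  | yes vd = contradiction (d , Sd , sym vd) none
      two-darts : ∀ {a} → InSub S a → dartVertex G a ≡ v → ∀ d →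
                  bit (S (proj₁ d) ∧ ⌊ v ≟ dartVertex G d ⌋) ≤ bit ⌊ d ≟ᴰ a ⌋ + bit ⌊ d ≟ᴰ ρ a ⌋
      two-darts {a} Sa va d with S (proj₁ d) in Sd | v ≟ dartVertex G d
      ... | false | _      = z≤n
      ... | true  | no _   = z≤n
      ... | true  | yes vd with d ≟ᴰ a | d ≟ᴰ ρ a | at-most-two {a} {d} Sa Sd (trans (sym vd) (sym va))
      ...   | yes _  | _      | _          = s≤s z≤n
      ...   | no _   | yes _  | _          = s≤s z≤n
      ...   | no d≢a | no _   | inj₁ d≡a   = contradiction d≡a d≢a
      ...   | no _   | no d≢ρa | inj₂ d≡ρa = contradiction d≡ρa d≢ρa

    count-bound : count S ≤ count V
    count-bound = double-cancel-≤ (begin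
      count S + count S                  ≡⟨ handshake S ⟨
      sum (degree S)                     ≤⟨ sum-mono-≤ degree-bound ⟩
      sum (λ v → bit (V v) + bit (V v))  ≡⟨ ∑-distrib-+ (bit ∘ V) (bit ∘ V) ⟩
      count V + count V                  ∎)
      where open Data.Nat.Properties.≤-Reasoning

    φ : Dart G → Dart G
    φ = faceStep ρ

    φ-flip-φ : ∀ {x} → InSub S x → φ (flipDart G (φ x)) ≡ flipDart G x
    φ-flip-φ {x} Sx = trans (cong ρ (flipDart-involutive _)) (ρ-involutive {flipDart G x} Sx)

    -- φ-flip-φ reduces the equation for j + 2 and x to the equation for j and φ x.
    faces-split : ∀ j {x} → InSub S x → ¬ (φ ^ j) x ≡ flipDart G x
    faces-split zero          {x} Sx x≡θx = flipDart-≢ x (sym x≡θx)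
    faces-split (suc zero)    {x} Sx φx≡θx = ρ-no-fixed {flipDart G x} Sx φx≡θx
    faces-split (suc (suc j)) {x} Sx eq =
      faces-split j (closed {flipDart G x} Sx)
        (faceStep-injective injective (trans (cong φ (sym (Orbits.^-suc φ j x))) (trans eq (sym (φ-flip-φ Sx)))))

    planar-witness : ∀ {e} → S e ≡ true → PlanarWitness S V ρ
    planar-witness {e} Se = record
      { faces    = (e , false) ∷ (e , true) ∷ []
      ; distinct = ((λ (j , eq) → faces-split j Se eq) ∷ []) ∷ [] ∷ []
      ; on-S     = Se ∷ Se ∷ []
      ; bound    = subst (λ h → count S + 1 + bit h ≤ 2 + count V) (sym (hasEdge-true Se))
                     (subst₂ _≤_ (sym (+-assoc (count S) 1 1)) (+-comm (count V) 2) (+-monoˡ-≤ 2 count-bound))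
      }

bridge-arith : ∀ {s s₁ s₂ c₁ c₂ f₁ f₂ v v₁ v₂ w w′ w″} →
               s₁ + 1 + c₁ ≤ f₁ + v₁ → s₂ + 1 + c₂ ≤ f₂ + v₂ → s₁ + s₂ + 1 ≡ s → v₁ + v₂ ≡ v →
               w ≡ f₁ + (f₂ + 1) → w ≤ w′ + c₂ → w′ ≤ w″ + c₁ → s + 1 + 1 ≤ w″ + v
bridge-arith {s} {s₁} {s₂} {c₁} {c₂} {f₁} {f₂} {v} {v₁} {v₂} {w} {w′} {w″} side₁ side₂ refl refl refl w≤ w′≤ =
  +-cancelʳ-≤ (c₁ + c₂) _ _ (begin
    s + 1 + 1 + (c₁ + c₂)                   ≡⟨ solve 4 (λ s₁ s₂ c₁ c₂ → s₁ :+ s₂ :+ con 1 :+ con 1 :+ con 1 :+ (c₁ :+ c₂)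
                                                        := s₁ :+ con 1 :+ c₁ :+ (s₂ :+ con 1 :+ c₂) :+ con 1)
                                                        refl s₁ s₂ c₁ c₂ ⟩
    s₁ + 1 + c₁ + (s₂ + 1 + c₂) + 1         ≤⟨ +-monoˡ-≤ 1 (+-mono-≤ side₁ side₂) ⟩
    f₁ + v₁ + (f₂ + v₂) + 1                 ≡⟨ solve 4 (λ f₁ v₁ f₂ v₂ → f₁ :+ v₁ :+ (f₂ :+ v₂) :+ con 1
                                                        := f₁ :+ (f₂ :+ con 1) :+ (v₁ :+ v₂)) refl f₁ v₁ f₂ v₂ ⟩
    f₁ + (f₂ + 1) + (v₁ + v₂)               ≤⟨ +-monoˡ-≤ (v₁ + v₂) (≤-trans w≤ (+-monoˡ-≤ c₂ w′≤)) ⟩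
    w″ + c₁ + c₂ + (v₁ + v₂)                ≡⟨ solve 4 (λ w c₁ c₂ v → w :+ c₁ :+ c₂ :+ v := w :+ v :+ (c₁ :+ c₂))
                                                        refl w″ c₁ c₂ (v₁ + v₂) ⟩
    w″ + (v₁ + v₂) + (c₁ + c₂)              ∎)
  where
  open Data.Nat.Properties.≤-Reasoning
  open +-*-Solver

_≡ᵇ_ : Bool → Bool → Bool
β ≡ᵇ n = if β then n else not n

≡ᵇ⁻ : ∀ β {n} → β ≡ᵇ n ≡ true → n ≡ β
≡ᵇ⁻ true  {true}  _ = refl
≡ᵇ⁻ false {false} _ = refl

≡ᵇ-refl : ∀ β → β ≡ᵇ β ≡ true
≡ᵇ-refl true  = refl
≡ᵇ-refl false = refl

∧-true : ∀ {a b} → a ∧ b ≡ true → a ≡ true × b ≡ true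
∧-true {true} {true} _ = refl , refl

module BridgeSplit (G : Graph) where

  open Graph G
  open Incidence G
  open Counting
  open Rotations G
  open Reachability G
  open Subgraphs G

  module Split {S V ρ} (rot : IsRotationOn (InSub S) ρ) (conn : IsConnectedOn S V) (noPair : NoRemovablePair S V)
               {b} (Sb : S b ≡ true) (cut : ¬ Connects (removeEdge S b) V)
               (near? : ∀ u → Dec (Reach G (removeEdge S b) (proj₁ (ends b)) u)) where

    open IsConnectedOn conn

    S′ : EdgeSet G
    S′ = removeEdge S b

    x y : Fin nV
    x = proj₁ (ends b)
    y = proj₂ (ends b)

    near : VertexSet
    near u = ⌊ near? u ⌋

    near-reach : ∀ {u} → near u ≡ true → Reach G S′ x u
    near-reach {u} near-u with near? u
    ... | yes r = r

    reach-near : ∀ {u} → Reach G S′ x u → near u ≡ true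
    reach-near {u} r with near? u
    ... | yes _ = refl
    ... | no ¬r = contradiction r ¬r

    S′⁻ : ∀ {e} → S′ e ≡ true → S e ≡ true × ¬ e ≡ b
    S′⁻ kept = let Se , e≢b , _ = removePair⁻ S b b kept in Se , e≢b

    x-or-y : ∀ {u} → V u ≡ true → Reach G S′ x u ⊎ Reach G S′ y u
    x-or-y {u} u∈V with reach-lastExit S S′ (connects x u (proj₁ (within b Sb)) u∈V)
    ... | inj₁ r = inj₁ r
    ... | inj₂ (e , Se , removed , z , z∈e , r) with Sum.reduce (removePair-removed S b b Se removed)
    ...   | refl with z∈e
    ...     | inj₁ refl = inj₁ r
    ...     | inj₂ refl = inj₂ r

    x↛y : ¬ Reach G S′ x y
    x↛y x~y = cut (connects-from x λ u u∈V → Sum.[ id , reach-trans x~y ] (x-or-y u∈V))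

    near-edge : ∀ {e a c} → S′ e ≡ true → Joins G e a c → near a ≡ near c
    near-edge {a = a} {c} kept j with near? a | near? c
    ... | yes _  | yes _  = refl
    ... | no _   | no _   = refl
    ... | yes ra | no ¬rc = contradiction (reach-trans ra (reach-edge _ kept j)) ¬rc
    ... | no ¬ra | yes rc = contradiction (reach-trans rc (reach-edge _ kept (Joins-sym j))) ¬ra

    dart-near : ∀ d → S′ (proj₁ d) ≡ true → near (dartVertex G d) ≡ near (proj₁ (ends (proj₁ d)))
    dart-near (e , false) kept = refl
    dart-near (e , true)  kept = sym (near-edge kept (Joins-ends e))

    base : Bool → Fin nV
    base true  = x
    base false = y

    near-base : ∀ β → near (base β) ≡ β
    near-base true  = reach-near here
    near-base false with near? y
    ... | yes x~y = contradiction x~y x↛y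
    ... | no _    = refl

    base∈V : ∀ β → V (base β) ≡ true
    base∈V true  = proj₁ (within b Sb)
    base∈V false = proj₂ (within b Sb)

    bridge-Joins : ∀ β → Joins G b (base β) (base (not β))
    bridge-Joins true  = Joins-ends b
    bridge-Joins false = Joins-sym (Joins-ends b)

    Vertices : Bool → VertexSet
    Vertices β u = V u ∧ (β ≡ᵇ near u)

    Edges : Bool → EdgeSet G
    Edges β e = S′ e ∧ (β ≡ᵇ near (proj₁ (ends e)))

    Vertices⁺ : ∀ {β u} → V u ≡ true → near u ≡ β → Vertices β u ≡ true
    Vertices⁺ {β} u∈V refl rewrite u∈V = ≡ᵇ-refl β

    Edges⁻ : ∀ {β e} → Edges β e ≡ true → S′ e ≡ true × near (proj₁ (ends e)) ≡ β
    Edges⁻ {β} kept = let S′e , side = ∧-true kept in S′e , ≡ᵇ⁻ β side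

    Edges⁺ : ∀ {β e} → S′ e ≡ true → near (proj₁ (ends e)) ≡ β → Edges β e ≡ true
    Edges⁺ {β} S′e refl rewrite S′e = ≡ᵇ-refl β

    Edges-⊆ : ∀ {β} → EdgeSubset (Edges β) S
    Edges-⊆ e = proj₁ ∘ S′⁻ ∘ proj₁ ∘ Edges⁻

    reach-from-base : ∀ {β u} → V u ≡ true → near u ≡ β → Reach G S′ (base β) u
    reach-from-base {true}  u∈V near-u = near-reach near-u
    reach-from-base {false} u∈V near-u with x-or-y u∈V
    ... | inj₁ x~u = contradiction (reach-near x~u) (Bool.not-¬ near-u)
    ... | inj₂ y~u = y~u

    reach-on-side : ∀ {β u w} → near u ≡ β → Reach G S′ u w → Reach G (Edges β) u w
    reach-on-side {β} near-u = reach-invariant S′ (Edges β) (λ a → near a ≡ β) stays near-u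
      where
      stays : ∀ {e a c} → S′ e ≡ true → Joins G e a c → near a ≡ β → near c ≡ β × Edges β e ≡ true
      stays {e} kept j near-a with IsEnd-Joins j (inj₁ refl)
      ... | inj₁ refl = trans (sym (near-edge kept j)) near-a , Edges⁺ kept near-a
      ... | inj₂ refl = trans (sym (near-edge kept j)) near-a , Edges⁺ kept (trans (sym (near-edge kept j)) near-a)

    side-connected : ∀ β → IsConnectedOn (Edges β) (Vertices β)
    side-connected β = record
      { within    = λ e kept → let S′e , near-e = Edges⁻ kept
                                   x∈V , y∈V = within e (proj₁ (S′⁻ S′e))
                               in Vertices⁺ x∈V near-e , Vertices⁺ y∈V (trans (sym (near-edge S′e (Joins-ends e))) near-e)
      ; connects  = connects-from (base β) λ u u∈ → let u∈V , side = ∧-true u∈ in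
                      reach-on-side (near-base β) (reach-from-base u∈V (≡ᵇ⁻ β side))
      ; inhabited = base β , Vertices⁺ (base∈V β) (near-base β)
      }

    side-noPair : ∀ β → NoRemovablePair (Edges β) (Vertices β)
    side-noPair β e f Ee Ef adj connected =
      noPair e f (Edges-⊆ e Ee) (Edges-⊆ f Ef) adj (connects-from (base β) reach)
      where
      T : EdgeSet G
      T = removePair G S e f
      e≢b : ¬ e ≡ b
      e≢b = proj₂ (S′⁻ (proj₁ (Edges⁻ Ee)))
      f≢b : ¬ f ≡ b
      f≢b = proj₂ (S′⁻ (proj₁ (Edges⁻ Ef)))
      this-side : EdgeSubset (removePair G (Edges β) e f) T
      this-side d kept = let Ed , d≢e , d≢f = removePair⁻ (Edges β) e f kept in removePair⁺ S e f (Edges-⊆ d Ed) d≢e d≢f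
      other-side : EdgeSubset (Edges (not β)) T
      other-side d Ed = removePair⁺ S e f (Edges-⊆ d Ed) (λ { refl → sides-differ Ed Ee }) (λ { refl → sides-differ Ed Ef })
        where
        sides-differ : ∀ {d} → Edges (not β) d ≡ true → Edges β d ≡ true → ⊥
        sides-differ E¬β Eβ = Bool.not-¬ (proj₂ (Edges⁻ Eβ)) (proj₂ (Edges⁻ E¬β))
      reach : ∀ u → V u ≡ true → Reach G T (base β) u
      reach u u∈V with near u Bool.≟ β
      ... | yes near-u = reach-mono this-side (connected (base β) u (Vertices⁺ (base∈V β) (near-base β)) (Vertices⁺ u∈V near-u))
      ... | no ¬near-u = reach-trans (reach-edge b (removePair⁺ S e f Sb (e≢b ∘ sym) (f≢b ∘ sym)) (bridge-Joins β))
                           (reach-mono other-side (reach-on-side (near-base (not β)) (reach-from-base u∈V (Bool.¬-not ¬near-u))))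

    count-Vertices : count (Vertices true) + count (Vertices false) ≡ count V
    count-Vertices = count-split V near

    count-Edges : count (Edges true) + count (Edges false) + 1 ≡ count S
    count-Edges = trans (cong (_+ 1) (trans (count-split S′ (near ∘ proj₁ ∘ ends)) S′≗))
                        (count-remove S b Sb)
      where
      S′≗ : count S′ ≡ count (λ e → S e ∧ not ⌊ e ≟ b ⌋)
      S′≗ = sum-cong-≗ λ e → cong (λ t → bit (S e ∧ t)) (Bool.∧-idem (not ⌊ e ≟ b ⌋))

    dx dy : Dart G
    dx = b , false
    dy = b , true

    b-dart : ∀ {d} → proj₁ d ≡ b → d ≡ dx ⊎ d ≡ dy
    b-dart {.b , false} refl = inj₁ refl
    b-dart {.b , true}  refl = inj₂ refl

    open IsRotationOn rot using () renaming (injective to ρ-injective)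

    ρ₁ ρ₂ : Dart G → Dart G
    ρ₁ = skip dx ρ
    ρ₂ = skip dy ρ₁

    ρ₁-injective : Injective _≡_ _≡_ ρ₁
    ρ₁-injective = skip-injective ρ-injective dx

    rot₁ : IsRotationOn (InSub S -ᴰ dx) ρ₁
    rot₁ = skip-rotation rot dx

    rot₂ : IsRotationOn (InSub S′) ρ₂
    rot₂ = IsRotationOn-⊆ to-K (from-K ∘ IsRotationOn.closed rot₂′ ∘ to-K) rot₂′
      where
      rot₂′ = skip-rotation rot₁ dy
      from-K : ∀ {d} → ((InSub S -ᴰ dx) -ᴰ dy) d → InSub S′ d
      from-K ((Sd , d≢dx) , d≢dy) = removePair⁺ S b b Sd not-b not-b
        where
        not-b : ¬ _ ≡ b
        not-b d∈b = Sum.[ d≢dx , d≢dy ] (b-dart d∈b)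
      to-K : ∀ {d} → InSub S′ d → ((InSub S -ᴰ dx) -ᴰ dy) d
      to-K S′d = let Sd , d∉b = S′⁻ S′d in (Sd , d∉b ∘ cong proj₁) , d∉b ∘ cong proj₁

    side-rotation : ∀ β → IsRotationOn (InSub (Edges β)) ρ₂
    side-rotation β = IsRotationOn-⊆ (proj₁ ∘ Edges⁻) stays rot₂
      where
      open IsRotationOn rot₂
      stays : ∀ {d} → InSub (Edges β) d → InSub (Edges β) (ρ₂ d)
      stays {d} Ed = let S′d , near-d = Edges⁻ Ed in
        Edges⁺ (closed S′d) (trans (sym (dart-near (ρ₂ d) (closed S′d)))
                            (trans (cong near (local S′d)) (trans (dart-near d S′d) near-d)))

    -- With no edge on one side, the dart of b there is alone at its vertex.
    empty-side-fixed : ∀ β {K ρ′} → IsRotationOn K ρ′ → (∀ {d} → K d → InSub S d) → ∀ {d} → K d →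
                       proj₁ d ≡ b → dartVertex G d ≡ base β → hasEdge (Edges β) ≡ false → ρ′ d ≡ d
    empty-side-fixed β {ρ′ = ρ′} rot′ K⊆S {d} Kd d∈b at-base empty with ρ′ d ≟ᴰ d
    ... | yes fixed = fixed
    ... | no moved with proj₁ (ρ′ d) ≟ b
    ...   | yes ρd∈b = ⊥-elim (Bool.not-¬ (near-base true) (trans (cong near b-loop) (near-base false)))
      where
      open IsRotationOn rot′
      ρd≡flip : ρ′ d ≡ flipDart G d
      ρd≡flip = same-edge-flip (trans d∈b (sym ρd∈b)) (moved ∘ sym)
      b-loop : x ≡ y
      b-loop = subst IsLoop d∈b (flip-loop d (trans (cong (dartVertex G) (sym ρd≡flip)) (local Kd)))
    ...   | no ρd∉b = contradiction (trans (sym (hasEdge-true (Edges⁺ S′ρd near-ρd))) empty) λ ()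
      where
      open IsRotationOn rot′
      S′ρd : S′ (proj₁ (ρ′ d)) ≡ true
      S′ρd = removePair⁺ S b b (K⊆S (closed Kd)) ρd∉b ρd∉b
      near-ρd : near (proj₁ (ends (proj₁ (ρ′ d)))) ≡ β
      near-ρd = trans (sym (dart-near (ρ′ d) S′ρd)) (trans (cong near (trans (local Kd) at-base)) (near-base β))

    side-closed : ∀ β {d} → InSub (Edges β) d → InSub (Edges β) (faceStep ρ₂ d)
    side-closed β {d} = IsRotationOn.closed (side-rotation β) {flipDart G d}

    assemble : PlanarWitness (Edges true) (Vertices true) ρ₂ → PlanarWitness (Edges false) (Vertices false) ρ₂ →
               ¬ ¬ PlanarWitness S V ρ
    assemble w₁ w₂ = do
      W′ , W′⊆W , distinct′ , |W|≤ ← skip-faces-bit ρ₁-injective dy (hasEdge (Edges false)) fixed-y distinct-W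
      W″ , W″⊆W′ , distinct″ , |W′|≤ ← skip-faces-bit ρ-injective dx (hasEdge (Edges true)) fixed-x distinct′
      return record
        { faces    = W″
        ; distinct = distinct″
        ; on-S     = All-resp-⊆ (⊆-trans W″⊆W′ W′⊆W) on-S-W
        ; bound    = subst (λ h → count S + 1 + bit h ≤ length W″ + count V) (sym (hasEdge-true Sb))
                       (bridge-arith {f₁ = length (faces w₁)} {f₂ = length (faces w₂)}
                                     {v₁ = count (Vertices true)} {v₂ = count (Vertices false)}
                                     (bound w₁) (bound w₂) count-Edges count-Vertices length-W |W|≤ |W′|≤)
        }
      where
      open PlanarWitness
      W : List (Dart G)
      W = faces w₁ ++ (faces w₂ ++ dx ∷ [])
      length-W : length W ≡ length (faces w₁) + (length (faces w₂) + 1)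
      length-W = trans (length-++ (faces w₁)) (cong (length (faces w₁) +_) (length-++ (faces w₂)))
      fixed-x : hasEdge (Edges true) ≡ false → ρ dx ≡ dx
      fixed-x = empty-side-fixed true rot id Sb refl refl
      fixed-y : hasEdge (Edges false) ≡ false → ρ₁ dy ≡ dy
      fixed-y = empty-side-fixed false rot₁ proj₁ (Sb , λ ()) refl refl
      distinct-W : DistinctFaces ρ₂ W
      distinct-W =
        Orbits.distinctOrbits-++ (faceStep ρ₂) (side-closed true)
          (λ Ed → Sum.[ (λ E¬d → Bool.not-¬ (proj₂ (Edges⁻ Ed)) (proj₂ (Edges⁻ E¬d)))
                      , (λ d∈b → proj₂ (S′⁻ (proj₁ (Edges⁻ Ed))) d∈b) ])
          (distinct w₁)
          (Orbits.distinctOrbits-++ (faceStep ρ₂) (side-closed false)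
             (λ Ed d∈b → proj₂ (S′⁻ (proj₁ (Edges⁻ Ed))) d∈b) (distinct w₂) ([] ∷ []) (on-S w₂) (refl ∷ []))
          (on-S w₁) (All.++⁺ (All.map inj₁ (on-S w₂)) (inj₂ refl ∷ []))
      on-S-W : All (InSub S) W
      on-S-W = All.++⁺ (All.map (Edges-⊆ _) (on-S w₁)) (All.++⁺ (All.map (Edges-⊆ _) (on-S w₂)) (Sb ∷ []))

module Planarity (G : Graph) where

  open Graph G
  open Counting
  open Rotations G
  open Reachability G
  open Subgraphs G

  edgeless-witness : ∀ {S V ρ} → IsConnectedOn S V → (∀ e → ¬ S e ≡ true) → PlanarWitness S V ρ
  edgeless-witness {S} {V} conn none = record
    { faces    = []
    ; distinct = []
    ; on-S     = []
    ; bound    = subst₂ (λ c h → c + 1 + bit h ≤ count V) (sym no-edges) (sym (hasEdge-false none)) (count-pos v v∈V)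
    }
    where
    open IsConnectedOn conn
    v = proj₁ inhabited
    v∈V = proj₂ inhabited
    no-edges : count S ≡ 0
    no-edges = count-false S λ e → Bool.¬-not (none e)

  planar-bound : ∀ n {S V ρ} → count S ≤ n → IsRotationOn (InSub S) ρ → IsConnectedOn S V →
                 NoRemovablePair S V → ¬ ¬ PlanarWitness S V ρ
  planar-bound zero {S} |S|≤0 rot conn noPair =
    return (edgeless-witness conn λ e Se → <⇒≱ (count-pos e Se) |S|≤0)
  planar-bound (suc n) {S} {V} |S|≤n rot conn noPair with hasEdge? S
  ... | no none = return (edgeless-witness conn λ e Se → none (e , Se))
  ... | yes (e , Se) = do
    yes (b , Sb , cut) ← ¬¬-excluded-middle {A = ∃[ b ] S b ≡ true × ¬ Connects (removeEdge S b) V}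
      where no no-bridge → return (Bridgeless.planar-witness G rot conn noPair (λ Sb cut → no-bridge (_ , Sb , cut)) Se)
    near? ← ¬¬-decide-Fin (Reach G (removeEdge S b) (proj₁ (ends b)))
    let open BridgeSplit.Split G rot conn noPair Sb cut near?
        sides≤n : count (Edges true) + count (Edges false) ≤ n
        sides≤n = ≤-pred (subst (_≤ suc n) (sym (trans (+-comm 1 _) count-Edges)) |S|≤n)
    w₁ ← planar-bound n (≤-trans (m≤m+n _ _) sides≤n) (side-rotation true) (side-connected true) (side-noPair true)
    w₂ ← planar-bound n (≤-trans (m≤n+m _ _) sides≤n) (side-rotation false) (side-connected false) (side-noPair false)
    assemble w₁ w₂

module FaceCount (G : Graph) where

  open Graph G
  open Incidence G
  open Rotations G
  open Function.Endo.Propositional (Dart G) using (_^_)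

  iter≡^ : ∀ f k d → iter G f k d ≡ (f ^ k) d
  iter≡^ f zero    d = refl
  iter≡^ f (suc k) d = cong f (iter≡^ f k d)

  ∈-allDarts : ∀ d → d ∈ allDarts G
  ∈-allDarts (e , b) = ∈-concatMap⁺ (λ e → (e , false) ∷ (e , true) ∷ []) (Any.map (λ { refl → both b }) (∈-allFin e))
    where
    both : ∀ b → (e , b) ∈ (e , false) ∷ (e , true) ∷ []
    both false = here refl
    both true  = there (here refl)

  length-without : ∀ m {L} → Unique L → length L ≤ suc (length (filter (λ d → ¬? (d ≟ᴰ m)) L))
  length-without m {[]}    []                 = z≤n
  length-without m {x ∷ L} (x∉L ∷ unique) with x ≟ᴰ m
  ... | yes refl = s≤s (≤-reflexive (cong length (sym (filter-all (λ d → ¬? (d ≟ᴰ m)) (All.map (_∘ sym) x∉L)))))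
  ... | no _     = s≤s (length-without m unique)

  unique-≤-countTrue : ∀ (p : Dart G → Bool) M {L} → Unique L → All (λ d → p d ≡ true) L →
                       (∀ {d} → d ∈ L → d ∈ M) → length L ≤ countTrue G p M
  unique-≤-countTrue p [] {[]} _ _ _ = z≤n
  unique-≤-countTrue p [] {x ∷ L} _ _ L⊆[] with () ← L⊆[] (here refl)
  unique-≤-countTrue p (m ∷ M) {L} unique pL L⊆M with p m in pm
  ... | true = ≤-trans (length-without m unique)
                 (s≤s (unique-≤-countTrue p M (Unique.filter⁺ _ unique) (All.filter⁺ _ pL) L′⊆M))
    where
    L′⊆M : ∀ {d} → d ∈ filter (λ d → ¬? (d ≟ᴰ m)) L → d ∈ M
    L′⊆M d∈L′ with ∈-filter⁻ (λ d → ¬? (d ≟ᴰ m)) d∈L′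
    ... | d∈L , d≢m with L⊆M d∈L
    ...   | here d≡m   = contradiction d≡m d≢m
    ...   | there d∈M = d∈M
  ... | false = unique-≤-countTrue p M unique pL L⊆M′
    where
    L⊆M′ : ∀ {d} → d ∈ L → d ∈ M
    L⊆M′ d∈L with L⊆M d∈L
    ... | here refl = contradiction (trans (sym (All.lookup pL d∈L)) pm) λ ()
    ... | there d∈M = d∈M

  module _ (R : Rotation G) where

    open Rotation R

    ρ-injective : Injective _≡_ _≡_ ρ
    ρ-injective {x} {y} eq = trans (sym (invˡ x)) (trans (cong ρ⁻¹ eq) (invˡ y))

    rotation : IsRotationOn (λ _ → ⊤) ρ
    rotation = record
      { injective  = ρ-injective
      ; closed     = λ _ → tt
      ; local      = λ {d} _ → local d
      ; transitive = λ {d} {d′} _ _ same → let k , eq = cyclic d d′ same in k , trans (sym (iter≡^ ρ k d)) eq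
      }

    allB-false : ∀ {p} ks → allB G p ks ≡ false → ∃[ k ] p k ≡ false
    allB-false {p} (k ∷ ks) all-false with p k in pk
    ... | false = k , pk
    ... | true  = allB-false ks all-false

    -- Unless x represents its face, a dart further along the face has a smaller code.
    face-rep : ∀ n x → dartCode G x < n → ∃[ r ] SameFace ρ x r × isOrbitRep G R r ≡ true
    face-rep (suc n) x x<n with isOrbitRep G R x in rep
    ... | true  = x , Orbits.orbit-refl (faceStep ρ) x , rep
    ... | false with allB-false (upTo (2 * nE)) rep
    ...   | k , not-below with dartCode G x ≤? dartCode G (iter G (facePerm G R) k x)
    ...     | no x≰y = let r , y~r , rep-r = face-rep n _ (≤-trans (≰⇒> x≰y) (≤-pred x<n)) in
                       r , Orbits.orbit-trans (faceStep ρ) (k , sym (iter≡^ (faceStep ρ) k x)) y~r , rep-r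

    faces≤faceCount : ∀ {W} → DistinctFaces ρ W → length W ≤ faceCount G R
    faces≤faceCount {W} distinct = begin
      length W                                    ≡⟨ length-map rep W ⟨
      length (map rep W)                          ≤⟨ unique-≤-countTrue (isOrbitRep G R) (allDarts G) reps-unique
                                                       (All.map⁺ (All.universal (proj₂ ∘ proj₂ ∘ face-rep′) W))
                                                       (λ {d} _ → ∈-allDarts d) ⟩
      countTrue G (isOrbitRep G R) (allDarts G)   ≤⟨ m≤n⊔m 1 _ ⟩
      faceCount G R                               ∎
      where
      open Data.Nat.Properties.≤-Reasoning
      open FiniteOrbits dartIndex dartIndex-injective (faceStep-injective ρ-injective) using (orbit-sym)
      face-rep′ : ∀ x → ∃[ r ] SameFace ρ x r × isOrbitRep G R r ≡ true
      face-rep′ x = face-rep (suc (dartCode G x)) x ≤-refl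
      rep : Dart G → Dart G
      rep = proj₁ ∘ face-rep′
      reps-unique : Unique (map rep W)
      reps-unique = AllPairs.map⁺ (AllPairs.map (λ {x} {y} x≁y rx≡ry → x≁y
        (Orbits.orbit-trans (faceStep ρ) (proj₁ (proj₂ (face-rep′ x)))
          (subst (λ r → SameFace ρ r y) (sym rx≡ry) (orbit-sym (proj₁ (proj₂ (face-rep′ y))))))) distinct)

module Greedy (G : Graph) where

  open Graph G
  open Incidence G
  open Counting
  open Reachability G
  open Subgraphs G

  count-removePair : ∀ S {e f} → S e ≡ true → S f ≡ true → ¬ e ≡ f → count (removePair G S e f) + 2 ≡ count S
  count-removePair S {e} {f} Se Sf e≢f = begin
    count (removePair G S e f) + 2  ≡⟨ cong (_+ 2) (sum-cong-≗ λ x → cong bit (Bool.∧-assoc (S x) _ _)) ⟨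
    count S∖e∖f + 2                 ≡⟨ +-assoc (count S∖e∖f) 1 1 ⟨
    count S∖e∖f + 1 + 1             ≡⟨ cong (_+ 1) (count-remove S∖e f S∖e-f) ⟩
    count S∖e + 1                   ≡⟨ count-remove S e Se ⟩
    count S                         ∎
    where
    open ≡-Reasoning
    S∖e : EdgeSet G
    S∖e x = S x ∧ not ⌊ x ≟ e ⌋
    S∖e∖f : EdgeSet G
    S∖e∖f x = S∖e x ∧ not ⌊ x ≟ f ⌋
    S∖e-f : S∖e f ≡ true
    S∖e-f rewrite Sf with f ≟ e
    ... | yes f≡e = contradiction (sym f≡e) e≢f
    ... | no _    = refl

  allV : VertexSet
  allV _ = true

  connectedOn-allV : ∀ {S} → ConnectedSub G S → IsConnectedOn S allV
  connectedOn-allV (nonempty , reach) = record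
    { within    = λ _ _ → refl , refl
    ; connects  = λ u w _ _ → reach u w
    ; inhabited = fromℕ< nonempty , refl
    }

  connectedSub-mono : ∀ {S S′} → EdgeSubset S S′ → ConnectedSub G S → ConnectedSub G S′
  connectedSub-mono S⊆S′ (nonempty , reach) = nonempty , λ u v → reach-mono S⊆S′ (reach u v)

  record Invariant (s : State G) : Set where
    field
      connected  : ConnectedSub G (State.H s)
      edge-count : count (State.H s) + 2 * length (State.P s) ≡ nE
      rejected   : ∀ {e f} → (e , f) ∈ State.tested s →
                   State.H s e ≡ false ⊎ State.H s f ≡ false ⊎ ¬ ConnectedSub G (removePair G (State.H s) e f)

  invariant-init : ConnectedSub G (allEdges G) → Invariant (initState G)
  invariant-init connected = record
    { connected  = connected
    ; edge-count = trans (+-identityʳ _) (count-true nE)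
    ; rejected   = λ ()
    }

  invariant-step : ∀ {s t} → Step G s t → Invariant s → Invariant t
  invariant-step (accept {H} {P} e f He Hf adj _ connected′) inv = record
    { connected  = connected′
    ; edge-count = begin
        count (removePair G H e f) + 2 * length (P ++ (e , f) ∷ [])
          ≡⟨ cong (λ n → count (removePair G H e f) + 2 * n) (trans (length-++ P) (+-comm (length P) 1)) ⟩
        count (removePair G H e f) + 2 * (1 + length P)
          ≡⟨ cong (count (removePair G H e f) +_) (*-distribˡ-+ 2 1 (length P)) ⟩
        count (removePair G H e f) + (2 + 2 * length P)
          ≡⟨ +-assoc (count (removePair G H e f)) 2 (2 * length P) ⟨
        count (removePair G H e f) + 2 + 2 * length P
          ≡⟨ cong (_+ 2 * length P) (count-removePair H He Hf (proj₁ adj)) ⟩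
        count H + 2 * length P
          ≡⟨ edge-count ⟩
        nE ∎
    ; rejected   = λ { (here refl) → inj₁ (Bool.¬-not λ kept → proj₁ (proj₂ (removePair⁻ H e f kept)) refl)
                     ; (there tested) → Sum.map still-off (Sum.map still-off (_∘ connectedSub-mono shrink))
                                          (rejected tested) }
    }
    where
    open ≡-Reasoning
    open Invariant inv
    still-off : ∀ {x} → H x ≡ false → removePair G H e f x ≡ false
    still-off Hx = Bool.¬-not λ kept → Bool.not-¬ Hx (removePair-⊆ H e f _ kept)
    shrink : ∀ {e′ f′} → EdgeSubset (removePair G (removePair G H e f) e′ f′) (removePair G H e′ f′)
    shrink {e′} {f′} x kept = let kept′ , x≢e′ , x≢f′ = removePair⁻ (removePair G H e f) e′ f′ kept in
                              removePair⁺ H e′ f′ (removePair-⊆ H e f x kept′) x≢e′ x≢f′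
  invariant-step (reject e f _ _ _ _ disconnected) inv = record
    { connected  = connected
    ; edge-count = edge-count
    ; rejected   = λ { (here refl) → inj₂ (inj₂ disconnected) ; (there tested) → rejected tested }
    }
    where open Invariant inv

  invariant-run : ∀ {s t} → Star (Step G) s t → Invariant s → Invariant t
  invariant-run ε            inv = inv
  invariant-run (move ◅ run) inv = invariant-run run (invariant-step move inv)

  rejected⇒disconnected : ∀ {S a b} → S a ≡ true → S b ≡ true →
           S a ≡ false ⊎ S b ≡ false ⊎ ¬ ConnectedSub G (removePair G S a b) → ¬ ConnectedSub G (removePair G S a b)
  rejected⇒disconnected Sa Sb (inj₁ Sa≡false)            = λ _ → Bool.not-¬ Sa Sa≡false
  rejected⇒disconnected Sa Sb (inj₂ (inj₁ Sb≡false))     = λ _ → Bool.not-¬ Sb Sb≡false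
  rejected⇒disconnected Sa Sb (inj₂ (inj₂ disconnected)) = disconnected

  terminal-noPair : ∀ {s} → Invariant s → Terminated G s → NoRemovablePair (State.H s) allV
  terminal-noPair {s} inv terminated e f He Hf adj connects =
    untested (terminated e f He Hf adj) (proj₁ (Invariant.connected inv) , λ u v → connects u v refl refl)
    where
    H : EdgeSet G
    H = State.H s
    untested : Tested G (State.tested s) e f → ¬ ConnectedSub G (removePair G H e f)
    untested (inj₁ tested) = rejected⇒disconnected {H} He Hf (Invariant.rejected inv tested)
    untested (inj₂ tested) = rejected⇒disconnected {H} Hf He (Invariant.rejected inv tested) ∘ connectedSub-mono (removePair-sym {H} {e} {f})

euler-arith : ∀ {g F V E c} → V + F + 2 * g ≡ 2 + E → E + 2 ≤ F + V + (c + c) → g ≤ c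
euler-arith {g} {F} {V} {E} {c} euler faces =
  *-cancelˡ-≤ 2 (+-cancelʳ-≤ (E + 2) _ _ (begin
    2 * g + (E + 2)            ≤⟨ +-monoʳ-≤ (2 * g) faces ⟩
    2 * g + (F + V + (c + c))  ≡⟨ solve 4 (λ g F V c → con 2 :* g :+ (F :+ V :+ (c :+ c)) := V :+ F :+ con 2 :* g :+ (c :+ c))
                                          refl g F V c ⟩
    V + F + 2 * g + (c + c)    ≡⟨ cong (_+ (c + c)) euler ⟩
    2 + E + (c + c)            ≡⟨ solve 2 (λ E c → con 2 :+ E :+ (c :+ c) := con 2 :* c :+ (E :+ con 2)) refl E c ⟩
    2 * c + (E + 2)            ∎))
  where
  open Data.Nat.Properties.≤-Reasoning
  open +-*-Solver

faces-arith : ∀ {c L n f v W W′ F} → c + L ≡ n → c + 1 + 1 ≤ f + v → W ≡ f + L → W ≤ W′ + (L + L) → W′ ≤ F →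
              n + 2 ≤ F + v + (L + L)
faces-arith {c} {L} {n} {f} {v} {W} {W′} {F} refl bound refl W≤ W′≤F = begin
  c + L + 2          ≡⟨ solve 2 (λ c L → c :+ L :+ con 2 := c :+ con 1 :+ con 1 :+ L) refl c L ⟩
  c + 1 + 1 + L      ≤⟨ +-monoˡ-≤ L bound ⟩
  f + v + L          ≡⟨ solve 3 (λ f v L → f :+ v :+ L := f :+ L :+ v) refl f v L ⟩
  f + L + v          ≤⟨ +-monoˡ-≤ v (≤-trans W≤ (+-monoˡ-≤ (L + L) W′≤F)) ⟩
  F + (L + L) + v    ≡⟨ solve 3 (λ F L v → F :+ (L :+ L) :+ v := F :+ v :+ (L :+ L)) refl F L v ⟩
  F + v + (L + L)    ∎
  where
  open Data.Nat.Properties.≤-Reasoning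
  open +-*-Solver

edgeless-arith : ∀ {L n v F} → L ≡ n → 1 ≤ F → 1 ≤ v → n + 2 ≤ F + v + (L + L)
edgeless-arith {L} {v = v} {F = F} refl 1≤F 1≤v =
  subst (_≤ F + v + (L + L)) (+-comm 2 L) (+-mono-≤ (+-mono-≤ 1≤F 1≤v) (m≤n+m L L))

module EdgeDeletion (G : Graph) (R : Rotation G) (H : EdgeSet G) where

  open import Data.List.Relation.Unary.AllPairs using (AllPairs)

  open Graph G
  open Counting
  open Rotations G
  open Subgraphs G
  open FaceCount G

  removed : List (Fin nE)
  removed = filter (λ e → H e Bool.≟ false) (allFin nE)

  count+removed : count H + length removed ≡ nE
  count+removed = count-filter (λ e → e) H

  removedDarts : List (Dart G)
  removedDarts = map (_, false) removed ++ map (_, true) removed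

  ∈-removedDarts⁺ : ∀ {d} → H (proj₁ d) ≡ false → d ∈ removedDarts
  ∈-removedDarts⁺ {e , false} He = ∈-++⁺ˡ (∈-map⁺ (_, false) (∈-filter⁺ (λ e → H e Bool.≟ false) (∈-allFin e) He))
  ∈-removedDarts⁺ {e , true}  He = ∈-++⁺ʳ _ (∈-map⁺ (_, true) (∈-filter⁺ (λ e → H e Bool.≟ false) (∈-allFin e) He))

  removed-off : All (λ e → H e ≡ false) removed
  removed-off = All.all-filter (λ e → H e Bool.≟ false) (allFin nE)

  ∈-removedDarts⁻ : ∀ {d} → d ∈ removedDarts → H (proj₁ d) ≡ false
  ∈-removedDarts⁻ d∈ with ∈-++⁻ (map (_, false) removed) d∈
  ... | inj₁ d∈ˡ with ∈-map⁻ (_, false) d∈ˡ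
  ...   | e , e∈ , refl = All.lookup removed-off e∈
  ∈-removedDarts⁻ d∈ | inj₂ d∈ʳ with ∈-map⁻ (_, true) d∈ʳ
  ...   | e , e∈ , refl = All.lookup removed-off e∈

  ρ : Dart G → Dart G
  ρ = Rotation.ρ R

  ρH : Dart G → Dart G
  ρH = skipAll removedDarts ρ

  rotationH : IsRotationOn (InSub H) ρH
  rotationH = IsRotationOn-⊆ kept (in-H ∘ IsRotationOn.closed rot ∘ kept) rot
    where
    rot = skipAll-rotation removedDarts (rotation R)
    kept : ∀ {d} → InSub H d → ((λ _ → ⊤) -ᴸ removedDarts) d
    kept Hd = tt , λ d∈ → Bool.not-¬ Hd (∈-removedDarts⁻ d∈)
    in-H : ∀ {d} → ((λ _ → ⊤) -ᴸ removedDarts) d → InSub H d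
    in-H (_ , d∉) = Bool.¬-not (d∉ ∘ ∈-removedDarts⁺)

  -- The two darts of a deleted edge form a face of their own, making up for one of the two skips.
  removed-face : ∀ {d} → H (proj₁ d) ≡ false → faceStep ρH d ≡ flipDart G d
  removed-face {d} Hd = skipAll-fixed (ρ-injective R) removedDarts (∈-removedDarts⁺ {flipDart G d} Hd)

  distinct-removed : DistinctFaces ρH (map (_, false) removed)
  distinct-removed = separate-all (Unique.filter⁺ _ (Unique.allFin⁺ nE)) removed-off
    where
    separate : ∀ {e e′} → H e ≡ false → ¬ e ≡ e′ → ¬ SameFace ρH (e , false) (e′ , false)
    separate {e} He e≢e′ same = e≢e′ (sym (Orbits.orbit-closed (faceStep ρH) {P = λ d → proj₁ d ≡ e} stays same refl))
      where
      stays : ∀ {d} → proj₁ d ≡ e → proj₁ (faceStep ρH d) ≡ e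
      stays {d} d∈e = trans (cong proj₁ (removed-face (subst (λ x → H x ≡ false) (sym d∈e) He))) d∈e
    separate-all : ∀ {L} → Unique L → All (λ e → H e ≡ false) L →
                   DistinctFaces ρH (map (_, false) L)
    separate-all AllPairs.[] [] = AllPairs.[]
    separate-all (e∉ AllPairs.∷ unique) (He ∷ off) = All.map⁺ (All.map (separate He) e∉) AllPairs.∷ separate-all unique off

  face-inequality : 1 ≤ nV → PlanarWitness H (Greedy.allV G) ρH →
                    ¬ ¬ (nE + 2 ≤ faceCount G R + nV + (length removed + length removed))
  face-inequality 1≤nV w = do
    W′ , distinct′ , |W|≤ ← skipAll-faces (ρ-injective R) removedDarts distinct-W
    return (by-edges (hasEdge H) refl (faces≤faceCount R distinct′) |W|≤)
    where
    open PlanarWitness w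
    W : List (Dart G)
    W = faces ++ map (_, false) removed
    distinct-W : DistinctFaces ρH W
    distinct-W = Orbits.distinctOrbits-++ (faceStep ρH) (λ {d} → IsRotationOn.closed rotationH {flipDart G d})
                   (λ Hd off → Bool.not-¬ Hd off) distinct distinct-removed on-S (All.map⁺ removed-off)
    length-W : length W ≡ length faces + length removed
    length-W = trans (length-++ faces) (cong (length faces +_) (length-map _ removed))
    length-RD : length removedDarts ≡ length removed + length removed
    length-RD = trans (length-++ (map (_, false) removed)) (cong₂ _+_ (length-map _ removed) (length-map _ removed))
    nV≡ : count (Greedy.allV G) ≡ nV
    nV≡ = count-true nV
    by-edges : ∀ h → hasEdge H ≡ h → ∀ {w′} → w′ ≤ faceCount G R → length W ≤ w′ + length removedDarts →
               nE + 2 ≤ faceCount G R + nV + (length removed + length removed)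
    by-edges true  has W′≤F W≤ =
      faces-arith count+removed (subst (λ v → count H + 1 + 1 ≤ length faces + v) nV≡
                                   (subst (λ h → count H + 1 + bit h ≤ _) has bound))
                  length-W (subst (λ r → length W ≤ _ + r) length-RD W≤) W′≤F
    by-edges false has _ _ = edgeless-arith (trans (cong (_+ length removed) (sym edgeless)) count+removed)
                                   (m≤m⊔n 1 (countTrue G (isOrbitRep G R) (allDarts G))) 1≤nV
      where
      edgeless : count H ≡ 0
      edgeless = count-false H λ e → Bool.¬-not λ He → Bool.not-¬ (hasEdge-true He) has

theorem7 : (G : Graph) → ConnectedSub G (allEdges G) →
    (s : State G) → Run G s → Terminated G s →
    (g : ℕ) → IsMaxGenus G g → g ≤ 2 * length (State.P s)
theorem7 G connected s run terminated g ((R , euler) , _) = decidable-stable (g ≤? 2 * length (State.P s)) do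
  w ← planar-bound (count H) ≤-refl rotationH (connectedOn-allV H-connected) (terminal-noPair inv terminated)
  faces ← face-inequality (proj₁ H-connected) w
  return (subst (g ≤_) removed≡2k (euler-arith {F = faceCount G R} {V = Graph.nV G} euler faces))
  where
  open Counting
  open Planarity G
  open Greedy G
  inv : Invariant s
  inv = invariant-run run (invariant-init connected)
  open Invariant inv renaming (connected to H-connected)
  H : EdgeSet G
  H = State.H s
  open EdgeDeletion G R H
  removed≡2k : length removed ≡ 2 * length (State.P s)
  removed≡2k = +-cancelˡ-≡ (count H) _ _ (trans count+removed (sym edge-count))
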